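{- If $G$ is a class $2$ graph, then $vs_{\chi'}(G)=\min\{vs_{\Delta}(G), vs_{class}(G)\}$.
   Context: All graphs are finite and simple. $\chi'(G)$ is the chromatic index and $\Delta(G)$ the maximum degree; $G$ is class $1$ if $\chi'(G)=\Delta(G)$ and class $2$ if $\chi'(G)=\Delta(G)+1$. The invariant $class(G)=\chi'(G)-\Delta(G)+1\in\{1,2\}$. For a graph invariant $\rho$, the $\rho$-vertex stability number $vs_{\rho}(G)$ is the minimum number of vertices of $G$ whose removal results in a graph $H\subseteq G$ with $\rho(H)\neq\rho(G)$ or with $E(H)=\emptyset$. -}

module Defs where

open import Data.Nat using (ℕ; zero; suc; _+_; _≤_; _⊔_)
open import Data.Fin using (Fin)
open import Data.Fin.Subset using (Subset; ∣_∣)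
open import Data.Bool using (Bool; true; false; _∧_; not; if_then_else_)
open import Data.Bool.Properties using (∧-comm)
open import Data.Vec using (lookup)
open import Data.List using (List; map; foldr; allFin)
open import Data.Nat.ListAction using (sum)
open import Data.Product using (Σ; _×_; _,_; ∃)
open import Relation.Binary.PropositionalEquality using (_≡_; _≢_; refl; cong; cong₂; trans)
open import Relation.Nullary using (¬_)

record Graph : Set where
  field
    n     : ℕ
    adj   : Fin n → Fin n → Bool
    sym   : ∀ u v → adj u v ≡ adj v u
    irrefl : ∀ u → adj u u ≡ false
open Graph public

-- G - S : delete the vertices of S.  Realised as the graph on the same
-- vertex set in which every vertex of S is isolated (all its edges are
-- removed); isolated vertices do not affect Δ, χ', class or E(H).
keepB : ∀ {n} → Subset n → Fin n → Bool
keepB S u = not (lookup S u)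

removeV : (G : Graph) → Subset (n G) → Graph
removeV G S = record
  { n = n G
  ; adj = λ u v → (keepB S u ∧ keepB S v) ∧ adj G u v
  ; sym = λ u v → cong₂ _∧_ (∧-comm (keepB S u) (keepB S v)) (Graph.sym G u v)
  ; irrefl = λ u → trans (cong ((keepB S u ∧ keepB S u) ∧_) (Graph.irrefl G u)) (lemma (keepB S u ∧ keepB S u))
  }
  where
  lemma : ∀ b → b ∧ false ≡ false
  lemma true = refl
  lemma false = refl

NoEdges : Graph → Set
NoEdges G = ∀ u v → adj G u v ≡ false

deg : (G : Graph) → Fin (n G) → ℕ
deg G v = sum (map (λ u → if adj G v u then 1 else 0) (allFin (n G)))

Δ : Graph → ℕ
Δ G = foldr _⊔_ 0 (map (deg G) (allFin (n G)))

EdgeColouring : Graph → ℕ → Set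
EdgeColouring G k =
  Σ (Fin (n G) → Fin (n G) → Fin k) λ c →
    (∀ u v → adj G u v ≡ true → c u v ≡ c v u) ×
    (∀ u v w → adj G u v ≡ true → adj G u w ≡ true → v ≢ w → c u v ≢ c u w)

IsChromaticIndex : Graph → ℕ → Set
IsChromaticIndex G k = EdgeColouring G k × (∀ j → EdgeColouring G j → k ≤ j)

Invariant : Set₁
Invariant = Graph → ℕ → Set

χ′ : Invariant
χ′ = IsChromaticIndex

ΔInv : Invariant
ΔInv G k = Δ G ≡ k

-- class(G) = χ'(G) − Δ(G) + 1, i.e. class(G) + Δ(G) = χ'(G) + 1
classInv : Invariant
classInv G k = ∃ λ χ → IsChromaticIndex G χ × (k + Δ G ≡ χ + 1)

Differs : Invariant → Graph → Graph → Set
Differs ρ G H = ∀ k → ρ G k → ¬ ρ H k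

Destab : Invariant → (G : Graph) → Subset (n G) → Set
Destab ρ G S = Differs ρ G (removeV G S) Data.Sum.⊎ NoEdges (removeV G S)
  where import Data.Sum

IsVS : Invariant → Graph → ℕ → Set
IsVS ρ G s =
  (Σ (Subset (n G)) λ S → Destab ρ G S × ∣ S ∣ ≡ s) ×
  (∀ S → Destab ρ G S → s ≤ ∣ S ∣)

Class2 : Graph → Set
Class2 G = IsChromaticIndex G (suc (Δ G))

module Submission where

-- Write H = G - S.  Since class = χ' - Δ + 1, a deletion changing χ' changes
-- Δ or the class, which gives min(vs_Δ, vs_class) ≤ vs_χ'.  Conversely, G
-- has χ'(G) = Δ(G) + 1, and by Vizing's theorem χ'(H) ≤ Δ(H) + 1 ≤ Δ(G) + 1;
-- so a deletion keeping χ' keeps Δ, and then also the class.  Hence every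
-- Δ- or class-destabilising set destabilises χ', giving vs_χ' ≤ vs_Δ, vs_class.
--
-- Most of the file proves Vizing's theorem through the extension lemma of
-- Ehrenfeucht, Faber and Kierstead: if G - u has a proper k-colouring in
-- which every neighbour of u misses two colours (one of them may miss only
-- one) and deg u ≤ k, then G has a proper k-colouring.  It is proved by
-- induction on k, counting spare colours and using a Kempe-chain
-- interchange.

open import Defs renaming (sym to adj-sym; irrefl to adj-irrefl)
open import Data.Nat using (ℕ; zero; suc; _+_; _*_; _∸_; _≤_; _<_; z≤n; s≤s; _⊔_; _⊓_; pred; s≤s⁻¹; _≤?_; _<?_)
open import Data.Nat.Properties
open import Data.Fin using (Fin; zero; suc; toℕ; fromℕ<)
open import Data.Fin.Properties using (any?; toℕ<n; toℕ-fromℕ<; toℕ-injective; pigeonhole) renaming (_≟_ to _≟F_)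
open import Data.Bool using (Bool; true; false; _∧_; _∨_; not; if_then_else_)
open import Data.Bool.Properties
  using (∧-comm; ∨-comm; not-involutive; not-injective; ∧-zeroʳ; ∨-identityʳ;
         ∧-conicalˡ; ∧-conicalʳ; ∨-conicalˡ; ∨-conicalʳ)
  renaming (_≟_ to _≟B_)
open import Data.Maybe using (Maybe; just; nothing; fromMaybe; is-just)
open import Data.List using (map; foldr; allFin; tabulate)
open import Data.List.Properties using (map-tabulate)
import Data.Nat.ListAction as List
open import Data.Product using (Σ; _×_; _,_; ∃; proj₁; proj₂)
open import Data.Sum using (_⊎_; inj₁; inj₂)
open import Data.Empty using (⊥; ⊥-elim)
open import Function using (_∘_)
open import Relation.Nullary using (¬_; Dec; yes; no; does)
open import Relation.Nullary.Decidable using (dec-true; dec-false)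
open import Relation.Binary.Definitions using (DecidableEquality; tri<; tri≈; tri>)
open import Relation.Binary.PropositionalEquality
open import Algebra.Properties.CommutativeMonoid.Sum +-0-commutativeMonoid
  using (sum; sum-cong-≗; ∑-distrib-+; ∑-comm; sum-replicate-zero)

ind : Bool → ℕ
ind true = 1
ind false = 0

bool-cases : ∀ (b : Bool) → b ≡ true ⊎ b ≡ false
bool-cases true = inj₁ refl
bool-cases false = inj₂ refl

false≢true : ∀ {a} → a ≡ false → a ≢ true
false≢true refl ()

∧-intro : ∀ {a b} → a ≡ true → b ≡ true → a ∧ b ≡ true
∧-intro refl refl = refl

∧-false : ∀ {a b} → a ∧ b ≡ false → a ≡ true → b ≡ false
∧-false {true} e refl = e

∨-intro₁ : ∀ {a b} → a ≡ true → a ∨ b ≡ true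
∨-intro₁ refl = refl

∨-intro₂ : ∀ {a b} → b ≡ true → a ∨ b ≡ true
∨-intro₂ {true} refl = refl
∨-intro₂ {false} refl = refl

∨-elim : ∀ {a b} → a ∨ b ≡ true → a ≡ true ⊎ b ≡ true
∨-elim {true} e = inj₁ refl
∨-elim {false} e = inj₂ e

≢⇒not : ∀ a b → a ≢ b → not a ≡ b
≢⇒not true true ne = ⊥-elim (ne refl)
≢⇒not true false ne = refl
≢⇒not false true ne = refl
≢⇒not false false ne = ⊥-elim (ne refl)

ind-true : ∀ {b} → 1 ≤ ind b → b ≡ true
ind-true {true} _ = refl

ind-false : ∀ {b} → ind b ≡ 0 → b ≡ false
ind-false {false} _ = refl

ind-∧ˡ : ∀ a b → ind (a ∧ b) ≤ ind a
ind-∧ˡ true true = ≤-refl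
ind-∧ˡ true false = z≤n
ind-∧ˡ false b = z≤n

ind-∧ʳ : ∀ a b → ind (a ∧ b) ≤ ind b
ind-∧ʳ true b = ≤-refl
ind-∧ʳ false true = z≤n
ind-∧ʳ false false = z≤n

ind-∨ : ∀ x y → (x ≡ true → y ≡ true → ⊥) → ind (x ∨ y) ≡ ind x + ind y
ind-∨ true true h = ⊥-elim (h refl refl)
ind-∨ true false h = refl
ind-∨ false y h = refl

ind-not : ∀ b → ind b + ind (not b) ≡ 1
ind-not true = refl
ind-not false = refl

module BoolEq {A : Set} (_≟_ : DecidableEquality A) where

  _==_ : A → A → Bool
  x == y = does (x ≟ y)

  ==-refl : ∀ x → (x == x) ≡ true
  ==-refl x = dec-true (x ≟ x) refl

  ≢⇒==-false : ∀ {x y} → x ≢ y → (x == y) ≡ false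
  ≢⇒==-false {x} {y} = dec-false (x ≟ y)

  ==⇒≡ : ∀ {x y} → (x == y) ≡ true → x ≡ y
  ==⇒≡ {x} {y} e with x ≟ y
  ... | yes p = p

  ≡⇒== : ∀ {x y} → x ≡ y → (x == y) ≡ true
  ≡⇒== {x} refl = ==-refl x

  ==-false⇒≢ : ∀ {x y} → (x == y) ≡ false → x ≢ y
  ==-false⇒≢ {x} e refl = false≢true e (==-refl x)

module _ {n : ℕ} where
  open BoolEq (_≟F_ {n}) public
open BoolEq _≟_ public using () renaming
  (_==_ to _=ℕ_; ==-refl to =ℕ-refl; ≢⇒==-false to ≢⇒=ℕ-false; ==⇒≡ to =ℕ⇒≡;
   ≡⇒== to ≡⇒=ℕ; ==-false⇒≢ to =ℕ-false⇒≢)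

find : ∀ {n} → (Fin n → Bool) → Maybe (Fin n)
find {zero} P = nothing
find {suc n} P with P zero
... | true = just zero
... | false with find (λ i → P (suc i))
... | just i = just (suc i)
... | nothing = nothing

find-just : ∀ {n} (P : Fin n → Bool) {y} → find P ≡ just y → P y ≡ true
find-just {suc n} P e with P zero in eq
find-just {suc n} P refl | true = eq
... | false with find (λ i → P (suc i)) in eq2
find-just {suc n} P refl | false | just i = find-just (λ i → P (suc i)) eq2

find-nothing : ∀ {n} (P : Fin n → Bool) → find P ≡ nothing → ∀ y → P y ≡ false
find-nothing {suc n} P e y with P zero in eq
find-nothing {suc n} P () y | true
... | false with find (λ i → P (suc i)) in eq2
find-nothing {suc n} P () y | false | just i
find-nothing {suc n} P e zero | false | nothing = eq
find-nothing {suc n} P e (suc y) | false | nothing = find-nothing (λ i → P (suc i)) eq2 y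

just-injective : ∀ {A : Set} {x y : A} → just x ≡ just y → x ≡ y
just-injective refl = refl

nothing≢just : ∀ {A : Set} {x : A} → nothing ≢ just x
nothing≢just ()

sum-mono : ∀ {n} {f g : Fin n → ℕ} → (∀ i → f i ≤ g i) → sum f ≤ sum g
sum-mono {zero} h = z≤n
sum-mono {suc n} h = +-mono-≤ (h zero) (sum-mono (h ∘ suc))

sum-const : ∀ {n} c → sum {n} (λ _ → c) ≡ n * c
sum-const {zero} c = refl
sum-const {suc n} c = cong (c +_) (sum-const {n} c)

count : ∀ {n} → (Fin n → Bool) → ℕ
count P = sum (ind ∘ P)

listSum-allFin : ∀ {n} (f : Fin n → ℕ) → List.sum (map f (allFin n)) ≡ sum f
listSum-allFin {n} f = trans (cong List.sum (map-tabulate (λ i → i) f)) (go f)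
  where
  go : ∀ {n} (f : Fin n → ℕ) → List.sum (tabulate f) ≡ sum f
  go {zero} f = refl
  go {suc n} f = cong (f zero +_) (go (f ∘ suc))

_∖_ : ∀ {n} → (Fin n → ℕ) → Fin n → Fin n → ℕ
(f ∖ a) i = if i == a then 0 else f i

-- The sum of a point mass at a (the tests `suc i == suc a` and `i == a`
-- agree by computation).
sum-point : ∀ {n} (a : Fin n) (c : ℕ) → sum (λ i → if i == a then c else 0) ≡ c
sum-point {suc n} zero c = trans (cong (c +_) (sum-replicate-zero n)) (+-identityʳ c)
sum-point {suc n} (suc a) c = sum-point a c

sum-split : ∀ {n} (f : Fin n → ℕ) (a : Fin n) → sum f ≡ f a + sum (f ∖ a)
sum-split f a =
  trans (sum-cong-≗ pointwise)
  (trans (∑-distrib-+ (λ i → if i == a then f a else 0) (f ∖ a))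
         (cong (_+ sum (f ∖ a)) (sum-point a (f a))))
  where
  pointwise : ∀ i → f i ≡ (if i == a then f a else 0) + (f ∖ a) i
  pointwise i with i ≟F a
  ... | yes refl = sym (+-identityʳ (f i))
  ... | no _ = refl

term≤sum : ∀ {n} (f : Fin n → ℕ) x → f x ≤ sum f
term≤sum f x = ≤-trans (m≤m+n (f x) _) (≤-reflexive (sym (sum-split f x)))

sum≡0 : ∀ {n} (f : Fin n → ℕ) → sum f ≡ 0 → ∀ i → f i ≡ 0
sum≡0 {suc n} f e zero = m+n≡0⇒m≡0 (f zero) e
sum≡0 {suc n} f e (suc i) = sum≡0 (f ∘ suc) (m+n≡0⇒n≡0 (f zero) e) i

sum-pos : ∀ {n} (f : Fin n → ℕ) → 1 ≤ sum f → ∃ λ i → 1 ≤ f i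
sum-pos {zero} f ()
sum-pos {suc n} f h with f zero in eq
... | suc k = zero , subst (1 ≤_) (sym eq) (s≤s z≤n)
... | zero with sum-pos (f ∘ suc) h
... | i , p = suc i , p

count-pos⇒find : ∀ {n} (P : Fin n → Bool) → 1 ≤ count P → ∃ λ i → find P ≡ just i × P i ≡ true
count-pos⇒find {n} P h with find P in e
... | just i = i , refl , find-just P e
... | nothing = ⊥-elim (1+n≰n (≤-trans h (≤-reflexive
                 (trans (sum-cong-≗ (λ i → cong ind (find-nothing P e i))) (sum-replicate-zero n)))))

Even : ℕ → Set
Even m = ∃ λ h → m ≡ h + h

Odd : ℕ → Set
Odd m = ∃ λ h → m ≡ suc (h + h)

odd⇒¬even : ∀ {m} → Odd m → ¬ Even m
odd⇒¬even (h , refl) (m , e) = go m h e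
  where
  go : ∀ m h → ¬ (suc (h + h) ≡ m + m)
  go zero h ()
  go (suc m) zero e = 0≢1+n (trans (suc-injective e) (+-suc m m))
  go (suc m) (suc h) e rewrite +-suc h h | +-suc m m = go m h (suc-injective (suc-injective e))

even-or-odd : ∀ m → Even m ⊎ Odd m
even-or-odd zero = inj₁ (0 , refl)
even-or-odd (suc m) with even-or-odd m
... | inj₁ (h , e) = inj₂ (h , cong suc e)
... | inj₂ (h , e) = inj₁ (suc h , trans (cong suc e) (cong suc (sym (+-suc h h))))

sum-even : ∀ {n} (f : Fin n → ℕ) → (∀ i → Even (f i)) → Even (sum f)
sum-even {zero} f h = 0 , refl
sum-even {suc n} f h with h zero | sum-even (f ∘ suc) (h ∘ suc)
... | a , ea | b , eb = a + b , trans (cong₂ _+_ ea eb) (regroup a b)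
  where
  open import Data.Nat.Tactic.RingSolver
  regroup : ∀ a b → (a + a) + (b + b) ≡ (a + b) + (a + b)
  regroup = solve-∀

degree-count : ∀ G v → deg G v ≡ count (adj G v)
degree-count G v = trans (listSum-allFin {n G} _) (sum-cong-≗ (λ u → if-ind (adj G v u)))
  where
  if-ind : ∀ b → (if b then 1 else 0) ≡ ind b
  if-ind true = refl
  if-ind false = refl

maxOf : ∀ {n} → (Fin n → ℕ) → ℕ
maxOf f = foldr _⊔_ 0 (tabulate f)

≤-maxOf : ∀ {n} (f : Fin n → ℕ) i → f i ≤ maxOf f
≤-maxOf {suc n} f zero = m≤m⊔n (f zero) _
≤-maxOf {suc n} f (suc i) = ≤-trans (≤-maxOf (f ∘ suc) i) (m≤n⊔m (f zero) _)

maxOf-least : ∀ {n} (f : Fin n → ℕ) M → (∀ i → f i ≤ M) → maxOf f ≤ M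
maxOf-least {zero} f M h = z≤n
maxOf-least {suc n} f M h = ⊔-lub (h zero) (maxOf-least (f ∘ suc) M (h ∘ suc))

Δ-maxOf : ∀ G → Δ G ≡ maxOf (deg G)
Δ-maxOf G = cong (foldr _⊔_ 0) (map-tabulate (λ i → i) (deg G))

deg≤Δ : ∀ G v → deg G v ≤ Δ G
deg≤Δ G v rewrite Δ-maxOf G = ≤-maxOf (deg G) v

Δ-least : ∀ G M → (∀ v → deg G v ≤ M) → Δ G ≤ M
Δ-least G M h rewrite Δ-maxOf G = maxOf-least (deg G) M h

Δ-removeV : ∀ G S → Δ (removeV G S) ≤ Δ G
Δ-removeV G S = Δ-least (removeV G S) (Δ G) λ v → begin
  deg (removeV G S) v                              ≡⟨ degree-count (removeV G S) v ⟩
  count (adj (removeV G S) v)                      ≤⟨ sum-mono (λ u → ind-∧ʳ (keepB S v ∧ keepB S u) (adj G v u)) ⟩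
  count (adj G v)                                  ≡⟨ degree-count G v ⟨
  deg G v                                          ≤⟨ deg≤Δ G v ⟩
  Δ G                                              ∎
  where open ≤-Reasoning

chromaticIndex-unique : ∀ {G a b} → IsChromaticIndex G a → IsChromaticIndex G b → a ≡ b
chromaticIndex-unique (ca , least-a) (cb , least-b) = ≤-antisym (least-a _ cb) (least-b _ ca)

record IsProper {m : ℕ} (E : Fin m → Fin m → Bool) (k : ℕ) (c : Fin m → Fin m → ℕ) : Set where
  field
    col-sym    : ∀ x y → E x y ≡ true → c x y ≡ c y x
    col-proper : ∀ x y z → E x y ≡ true → E x z ≡ true → y ≢ z → c x y ≢ c x z
    col-bound  : ∀ x y → E x y ≡ true → c x y < k
open IsProper public

Colouring : Graph → ℕ → Set
Colouring G k = Σ (Fin (n G) → Fin (n G) → ℕ) (IsProper (adj G) k)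

IsProper-⊆ : ∀ {m} {E E' : Fin m → Fin m → Bool} {k c} →
  (∀ {x y} → E' x y ≡ true → E x y ≡ true) → IsProper E k c → IsProper E' k c
IsProper-⊆ E'⊆E P = record
  { col-sym    = λ x y a → col-sym P x y (E'⊆E a)
  ; col-proper = λ x y z a b ne → col-proper P x y z (E'⊆E a) (E'⊆E b) ne
  ; col-bound  = λ x y a → col-bound P x y (E'⊆E a)
  }

-- Turning natural-number colours below k into colours in Fin k; on
-- non-edges the (irrelevant) colour 0 is used.
toEdgeColouring : ∀ G k → Colouring G (suc k) → EdgeColouring G (suc k)
toEdgeColouring G k (c , P) = colour , symmetric , proper
  where
  colour : Fin (n G) → Fin (n G) → Fin (suc k)
  colour x y with c x y <? suc k
  ... | yes lt = fromℕ< lt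
  ... | no _ = zero
  toℕ-colour : ∀ x y → adj G x y ≡ true → toℕ (colour x y) ≡ c x y
  toℕ-colour x y a with c x y <? suc k
  ... | yes lt = toℕ-fromℕ< lt
  ... | no ge = ⊥-elim (ge (col-bound P x y a))
  symmetric : ∀ x y → adj G x y ≡ true → colour x y ≡ colour y x
  symmetric x y a = toℕ-injective (begin
    toℕ (colour x y) ≡⟨ toℕ-colour x y a ⟩
    c x y            ≡⟨ col-sym P x y a ⟩
    c y x            ≡⟨ toℕ-colour y x (trans (adj-sym G y x) a) ⟨
    toℕ (colour y x) ∎)
    where open ≡-Reasoning
  proper : ∀ x y z → adj G x y ≡ true → adj G x z ≡ true → y ≢ z → colour x y ≢ colour x z
  proper x y z a b ne e = col-proper P x y z a b ne
    (trans (sym (toℕ-colour x y a)) (trans (cong toℕ e) (toℕ-colour x z b)))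

-- squeeze a removes the colour a from the palette ℕ: colours above a move
-- down by one.  unsqueeze a is its inverse, which never returns a.
squeeze : ℕ → ℕ → ℕ
squeeze a γ with γ <? a
... | yes _ = γ
... | no _ = pred γ

unsqueeze : ℕ → ℕ → ℕ
unsqueeze a δ with δ <? a
... | yes _ = δ
... | no _ = suc δ

unsqueeze-squeeze : ∀ a γ → γ ≢ a → unsqueeze a (squeeze a γ) ≡ γ
unsqueeze-squeeze a γ ne with γ <? a
... | yes p with γ <? a
...   | yes _ = refl
...   | no np = ⊥-elim (np p)
unsqueeze-squeeze a zero ne | no p = ⊥-elim (ne (sym (n≤0⇒n≡0 (≮⇒≥ p))))
unsqueeze-squeeze a (suc γ) ne | no p with γ <? a
... | yes q = ⊥-elim (ne (≤-antisym q (≮⇒≥ p)))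
... | no _ = refl

squeeze-unsqueeze : ∀ a δ → squeeze a (unsqueeze a δ) ≡ δ
squeeze-unsqueeze a δ with δ <? a
... | yes p with δ <? a
...   | yes _ = refl
...   | no np = ⊥-elim (np p)
squeeze-unsqueeze a δ | no p with suc δ <? a
... | yes q = ⊥-elim (p (<-trans (n<1+n δ) q))
... | no _ = refl

unsqueeze≢ : ∀ a δ → unsqueeze a δ ≢ a
unsqueeze≢ a δ with δ <? a
... | yes p = <⇒≢ p
... | no p = λ e → p (subst (δ <_) e ≤-refl)

unsqueeze-injective : ∀ a δ δ' → unsqueeze a δ ≡ unsqueeze a δ' → δ ≡ δ'
unsqueeze-injective a δ δ' e =
  trans (sym (squeeze-unsqueeze a δ)) (trans (cong (squeeze a) e) (squeeze-unsqueeze a δ'))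

squeeze-injective : ∀ a γ γ' → γ ≢ a → γ' ≢ a → squeeze a γ ≡ squeeze a γ' → γ ≡ γ'
squeeze-injective a γ γ' ne ne' e =
  trans (sym (unsqueeze-squeeze a γ ne)) (trans (cong (unsqueeze a) e) (unsqueeze-squeeze a γ' ne'))

squeeze-bound : ∀ {k} a γ → a < suc k → γ ≢ a → γ < suc k → squeeze a γ < k
squeeze-bound a γ ak ne γk with γ <? a
... | yes p = <-≤-trans p (s≤s⁻¹ ak)
squeeze-bound a zero ak ne γk | no p = ⊥-elim (ne (sym (n≤0⇒n≡0 (≮⇒≥ p))))
squeeze-bound a (suc γ) ak ne γk | no p = s≤s⁻¹ γk

unsqueeze-bound : ∀ {k} a δ → a < suc k → δ < k → unsqueeze a δ < suc k
unsqueeze-bound a δ ak δk with δ <? a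
... | yes p = <-trans δk (n<1+n _)
... | no p = s≤s δk

module Transposition (α β : ℕ) (α≢β : α ≢ β) where

  swap : ℕ → ℕ
  swap γ with γ ≟ α | γ ≟ β
  ... | yes _ | _ = β
  ... | no _ | yes _ = α
  ... | no _ | no _ = γ

  swap-α : swap α ≡ β
  swap-α with α ≟ α
  ... | yes _ = refl
  ... | no ne = ⊥-elim (ne refl)

  swap-β : swap β ≡ α
  swap-β with β ≟ α | β ≟ β
  ... | yes e | _ = ⊥-elim (α≢β (sym e))
  ... | no _ | yes _ = refl
  ... | no _ | no ne = ⊥-elim (ne refl)

  swap-other : ∀ γ → γ ≢ α → γ ≢ β → swap γ ≡ γ
  swap-other γ n1 n2 with γ ≟ α | γ ≟ β
  ... | yes e | _ = ⊥-elim (n1 e)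
  ... | no _ | yes e = ⊥-elim (n2 e)
  ... | no _ | no _ = refl

  swap-involutive : ∀ γ → swap (swap γ) ≡ γ
  swap-involutive γ = by-cases (γ ≟ α) (γ ≟ β)
    where
    by-cases : Dec (γ ≡ α) → Dec (γ ≡ β) → swap (swap γ) ≡ γ
    by-cases (yes refl) _ = trans (cong swap swap-α) swap-β
    by-cases (no n1) (yes refl) = trans (cong swap swap-β) swap-α
    by-cases (no n1) (no n2) = trans (cong swap (swap-other γ n1 n2)) (swap-other γ n1 n2)

  swap-injective : ∀ x y → swap x ≡ swap y → x ≡ y
  swap-injective x y e = trans (sym (swap-involutive x)) (trans (cong swap e) (swap-involutive y))

  swap-bound : ∀ {k} γ → α < k → β < k → γ < k → swap γ < k
  swap-bound γ ak bk gk with γ ≟ α | γ ≟ β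
  ... | yes _ | _ = bk
  ... | no _ | yes _ = ak
  ... | no _ | no _ = gk

  swap-=ℕ : ∀ x γ → (swap x =ℕ γ) ≡ (x =ℕ swap γ)
  swap-=ℕ x γ = by-cases (swap x ≟ γ)
    where
    by-cases : Dec (swap x ≡ γ) → (swap x =ℕ γ) ≡ (x =ℕ swap γ)
    by-cases (yes e) = trans (≡⇒=ℕ e) (sym (≡⇒=ℕ {x} {swap γ} (trans (sym (swap-involutive x)) (cong swap e))))
    by-cases (no ne) = trans (≢⇒=ℕ-false ne)
                         (sym (≢⇒=ℕ-false {x} {swap γ} (λ e → ne (trans (cong swap e) (swap-involutive γ)))))

adj⁻ : (G : Graph) → Fin (n G) → Fin (n G) → Fin (n G) → Bool
adj⁻ G u x y = adj G x y ∧ (not (x == u) ∧ not (y == u))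

adj⁻⇒adj : ∀ G u {x y} → adj⁻ G u x y ≡ true → adj G x y ≡ true
adj⁻⇒adj G u = ∧-conicalˡ _ _

adj⁻⇒≢₁ : ∀ G u {x y} → adj⁻ G u x y ≡ true → x ≢ u
adj⁻⇒≢₁ G u {x} {y} e = ==-false⇒≢ (not-injective (∧-conicalˡ _ _ (∧-conicalʳ (adj G x y) _ e)))

adj⁻⇒≢₂ : ∀ G u {x y} → adj⁻ G u x y ≡ true → y ≢ u
adj⁻⇒≢₂ G u {x} {y} e = ==-false⇒≢ (not-injective (∧-conicalʳ (not (x == u)) _ (∧-conicalʳ (adj G x y) _ e)))

adj⁻-intro : ∀ G u {x y} → adj G x y ≡ true → x ≢ u → y ≢ u → adj⁻ G u x y ≡ true
adj⁻-intro G u a nx ny = ∧-intro a (∧-intro (cong not (≢⇒==-false nx)) (cong not (≢⇒==-false ny)))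

adj⁻-sym : ∀ G u x y → adj⁻ G u x y ≡ adj⁻ G u y x
adj⁻-sym G u x y = cong₂ _∧_ (adj-sym G x y) (∧-comm (not (x == u)) (not (y == u)))

adj⇒≢ : ∀ G {x y} → adj G x y ≡ true → x ≢ y
adj⇒≢ G {x} a refl = false≢true (adj-irrefl G x) a

Misses : (G : Graph) → Fin (n G) → (Fin (n G) → Fin (n G) → ℕ) → Fin (n G) → ℕ → Set
Misses G u c w γ = ∀ x → adj⁻ G u w x ≡ true → c w x ≢ γ

record Config (k : ℕ) (G : Graph) (u : Fin (n G)) : Set where
  field
    col       : Fin (n G) → Fin (n G) → ℕ
    col-ok    : IsProper (adj⁻ G u) k col
    special   : Fin (n G)
    miss₁     : Fin (n G) → ℕ
    miss₂     : Fin (n G) → ℕ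
    miss₁-ok  : ∀ w → adj G u w ≡ true → Misses G u col w (miss₁ w) × miss₁ w < k
    miss₂-ok  : ∀ w → adj G u w ≡ true → w ≢ special →
                Misses G u col w (miss₂ w) × miss₂ w < k × miss₁ w ≢ miss₂ w
    deg-bound : count (adj G u) ≤ k

  spare : Fin (n G) → ℕ → Bool
  spare w γ = (miss₁ w =ℕ γ) ∨ (not (w == special) ∧ (miss₂ w =ℕ γ))

  spare-misses : ∀ w γ → adj G u w ≡ true → spare w γ ≡ true → Misses G u col w γ × γ < k
  spare-misses w γ a e with ∨-elim e
  ... | inj₁ e₁ = subst (λ z → Misses G u col w z × z < k) (=ℕ⇒≡ e₁) (miss₁-ok w a)
  ... | inj₂ e₂ = let (m , b , _) = miss₂-ok w a (==-false⇒≢ (not-injective (∧-conicalˡ _ _ e₂)))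
                  in subst (λ z → Misses G u col w z × z < k) (=ℕ⇒≡ (∧-conicalʳ _ _ e₂)) (m , b)

  not-spare₁ : ∀ w γ → spare w γ ≡ false → miss₁ w ≢ γ
  not-spare₁ w γ e = =ℕ-false⇒≢ (∨-conicalˡ _ _ e)

  not-spare₂ : ∀ w γ → spare w γ ≡ false → w ≢ special → miss₂ w ≢ γ
  not-spare₂ w γ e ns = =ℕ-false⇒≢ (∧-false (∨-conicalʳ _ _ e) (cong not (≢⇒==-false ns)))

open Config public

Extendable : ℕ → Set
Extendable k = ∀ G u → Config k G u → Colouring G k

extend-isolated : ∀ {k} G u (S : Config k G u) → (∀ w → adj G u w ≡ false) → Colouring G k
extend-isolated G u S isolated = col S , IsProper-⊆ avoids-u (col-ok S)
  where
  avoids-u : ∀ {x y} → adj G x y ≡ true → adj⁻ G u x y ≡ true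
  avoids-u {x} {y} a = adj⁻-intro G u a (λ { refl → false≢true (isolated y) a })
                                         (λ { refl → false≢true (isolated x) (trans (adj-sym G u x) a) })

UniqueSpare : ∀ {k} G u → Config k G u → Fin (n G) → ℕ → Set
UniqueSpare G u S v γ =
  adj G u v ≡ true × spare S v γ ≡ true × (∀ w → adj G u w ≡ true → w ≢ v → spare S w γ ≡ false)

squeeze-proper : ∀ {m} {E E' : Fin m → Fin m → Bool} {k c} α → α < suc k →
  (∀ {x y} → E' x y ≡ true → E x y ≡ true × c x y ≢ α) →
  IsProper E (suc k) c → IsProper E' k (λ x y → squeeze α (c x y))
squeeze-proper {c = c} α α<k E'⇒ P = record
  { col-sym    = λ x y a → cong (squeeze α) (col-sym P x y (proj₁ (E'⇒ a)))
  ; col-proper = λ x y z a b ne e → col-proper P x y z (proj₁ (E'⇒ a)) (proj₁ (E'⇒ b)) ne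
                   (squeeze-injective α _ _ (proj₂ (E'⇒ a)) (proj₂ (E'⇒ b)) e)
  ; col-bound  = λ x y a → squeeze-bound α (c x y) α<k (proj₂ (E'⇒ a)) (col-bound P x y (proj₁ (E'⇒ a)))
  }

-- A colour α that is a spare colour of exactly one neighbour v of u can be
-- given to the edge uv.  Delete uv and every α-coloured edge and drop α
-- from the palette: this leaves a configuration with one colour fewer, and
-- any colouring of the smaller graph extends back to G by colouring every
-- deleted edge α.
module ReduceUniqueSpare {k' : ℕ} (IH : Extendable k') (G : Graph) (u : Fin (n G))
  (S : Config (suc k') G u) (v : Fin (n G)) (α : ℕ) (unique : UniqueSpare G u S v α) where

  c : Fin (n G) → Fin (n G) → ℕ
  c = col S

  uv-edge : adj G u v ≡ true
  uv-edge = proj₁ unique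

  v-misses-α : Misses G u c v α
  v-misses-α = proj₁ (spare-misses S v α uv-edge (proj₁ (proj₂ unique)))

  α<k : α < suc k'
  α<k = proj₂ (spare-misses S v α uv-edge (proj₁ (proj₂ unique)))

  others-keep-α : ∀ w → adj G u w ≡ true → w ≢ v → spare S w α ≡ false
  others-keep-α = proj₂ (proj₂ unique)

  -- The deleted edges: uv and the α-coloured edges of G - u (the colour is
  -- tested in both directions so that the relation is visibly symmetric).
  deleted : Fin (n G) → Fin (n G) → Bool
  deleted x y = (adj⁻ G u x y ∧ ((c x y =ℕ α) ∧ (c y x =ℕ α)))
              ∨ (((x == u) ∧ (y == v)) ∨ ((y == u) ∧ (x == v)))

  deleted-sym : ∀ x y → deleted x y ≡ deleted y x
  deleted-sym x y = cong₂ _∨_ (cong₂ _∧_ (adj⁻-sym G u x y) (∧-comm (c x y =ℕ α) (c y x =ℕ α)))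
                              (∨-comm ((x == u) ∧ (y == v)) ((y == u) ∧ (x == v)))

  Gα : Graph
  Gα = record
    { n = n G
    ; adj = λ x y → adj G x y ∧ not (deleted x y)
    ; sym = λ x y → cong₂ _∧_ (adj-sym G x y) (cong not (deleted-sym x y))
    ; irrefl = λ x → cong (_∧ not (deleted x x)) (adj-irrefl G x)
    }

  Gα-edge : ∀ {x y} → adj Gα x y ≡ true → adj G x y ≡ true × deleted x y ≡ false
  Gα-edge {x} {y} e = ∧-conicalˡ _ _ e , not-injective (∧-conicalʳ (adj G x y) _ e)

  Gα-edge-intro : ∀ {x y} → adj G x y ≡ true → deleted x y ≡ false → adj Gα x y ≡ true
  Gα-edge-intro a d rewrite d = ∧-intro a refl

  Gα⁻-edge : ∀ {x y} → adj⁻ Gα u x y ≡ true → adj⁻ G u x y ≡ true × c x y ≢ α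
  Gα⁻-edge {x} {y} e = a⁻ , not-α
    where
    a⁻ : adj⁻ G u x y ≡ true
    a⁻ = adj⁻-intro G u (proj₁ (Gα-edge (adj⁻⇒adj Gα u e))) (adj⁻⇒≢₁ Gα u e) (adj⁻⇒≢₂ Gα u e)
    not-α : c x y ≢ α
    not-α ce = false≢true (∧-false (∨-conicalˡ _ _ (proj₂ (Gα-edge (adj⁻⇒adj Gα u e)))) a⁻)
                 (∧-intro (≡⇒=ℕ ce) (≡⇒=ℕ (trans (sym (col-sym (col-ok S) x y a⁻)) ce)))

  uv-is-deleted : deleted u v ≡ true
  uv-is-deleted = ∨-intro₂ {adj⁻ G u u v ∧ _} (∨-intro₁ (∧-intro (==-refl u) (==-refl v)))

  uv-deleted : adj Gα u v ≡ false
  uv-deleted rewrite uv-is-deleted = ∧-zeroʳ (adj G u v)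

  Gα-neighbour : ∀ {w} → adj Gα u w ≡ true → adj G u w ≡ true × w ≢ v
  Gα-neighbour e = proj₁ (Gα-edge e) , λ { refl → false≢true uv-deleted e }

  -- u lost its neighbour v.
  Gα-degree : count (adj Gα u) ≤ k'
  Gα-degree = s≤s⁻¹ (begin
    suc (count (adj Gα u))               ≤⟨ s≤s (sum-mono below) ⟩
    suc (sum (d ∖ v))                    ≡⟨ cong (_+ sum (d ∖ v)) (cong ind uv-edge) ⟨
    d v + sum (d ∖ v)                    ≡⟨ sum-split d v ⟨
    count (adj G u)                      ≤⟨ deg-bound S ⟩
    suc k'                               ∎)
    where
    open ≤-Reasoning
    d : Fin (n G) → ℕ
    d = ind ∘ adj G u
    below : ∀ w → ind (adj Gα u w) ≤ (d ∖ v) w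
    below w = by-cases (w ≟F v)
      where
      by-cases : Dec (w ≡ v) → ind (adj Gα u w) ≤ (d ∖ v) w
      by-cases (yes refl) rewrite uv-deleted = z≤n
      by-cases (no ne) = ≤-trans (ind-∧ˡ (adj G u w) (not (deleted u w)))
        (≤-reflexive (cong (λ b → if b then 0 else d w) (sym (≢⇒==-false ne))))

  -- The reduced configuration: squeezing out α keeps every other colour,
  -- in particular the designated missing colours of the neighbours w ≠ v.
  reduced : Config k' Gα u
  reduced = record
    { col       = λ x y → squeeze α (c x y)
    ; col-ok    = squeeze-proper α α<k Gα⁻-edge (col-ok S)
    ; special   = special S
    ; miss₁     = λ w → squeeze α (miss₁ S w)
    ; miss₂     = λ w → squeeze α (miss₂ S w)
    ; miss₁-ok  = miss₁-reduced
    ; miss₂-ok  = miss₂-reduced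
    ; deg-bound = Gα-degree
    }
    where
    misses-reduced : ∀ w γ → Misses G u c w γ → γ ≢ α →
                     Misses Gα u (λ x y → squeeze α (c x y)) w (squeeze α γ)
    misses-reduced w γ m γ≢α x a e =
      m x (proj₁ (Gα⁻-edge a)) (squeeze-injective α _ _ (proj₂ (Gα⁻-edge a)) γ≢α e)
    miss₁-reduced : ∀ w → adj Gα u w ≡ true →
      Misses Gα u (λ x y → squeeze α (c x y)) w (squeeze α (miss₁ S w)) × squeeze α (miss₁ S w) < k'
    miss₁-reduced w a =
      let (aG , w≢v) = Gα-neighbour a
          p≢α = not-spare₁ S w α (others-keep-α w aG w≢v)
          (m , b) = miss₁-ok S w aG
      in misses-reduced w _ m p≢α , squeeze-bound α (miss₁ S w) α<k p≢α b
    miss₂-reduced : ∀ w → adj Gα u w ≡ true → w ≢ special S →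
      Misses Gα u (λ x y → squeeze α (c x y)) w (squeeze α (miss₂ S w)) ×
      squeeze α (miss₂ S w) < k' × squeeze α (miss₁ S w) ≢ squeeze α (miss₂ S w)
    miss₂-reduced w a ns =
      let (aG , w≢v) = Gα-neighbour a
          p≢α = not-spare₁ S w α (others-keep-α w aG w≢v)
          q≢α = not-spare₂ S w α (others-keep-α w aG w≢v) ns
          (m , b , p≢q) = miss₂-ok S w aG ns
      in misses-reduced w _ m q≢α , squeeze-bound α (miss₂ S w) α<k q≢α b ,
         (λ e → p≢q (squeeze-injective α _ _ p≢α q≢α e))

  -- The deleted edges form a matching, so colouring them all α is proper:
  -- α-coloured edges of G - u are pairwise disjoint, avoid u, and avoid v
  -- since v misses α.
  Deleted : Fin (n G) → Fin (n G) → Set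
  Deleted x y = (adj⁻ G u x y ≡ true × c x y ≡ α) ⊎ ((x ≡ u × y ≡ v) ⊎ (y ≡ u × x ≡ v))

  deleted⇒ : ∀ x y → deleted x y ≡ true → Deleted x y
  deleted⇒ x y e with ∨-elim e
  ... | inj₁ e₁ = inj₁ (∧-conicalˡ _ _ e₁ , =ℕ⇒≡ (∧-conicalˡ _ _ (∧-conicalʳ (adj⁻ G u x y) _ e₁)))
  ... | inj₂ e₂ with ∨-elim e₂
  ...   | inj₁ e₃ = inj₂ (inj₁ (==⇒≡ (∧-conicalˡ _ _ e₃) , ==⇒≡ (∧-conicalʳ (x == u) _ e₃)))
  ...   | inj₂ e₃ = inj₂ (inj₂ (==⇒≡ (∧-conicalˡ _ _ e₃) , ==⇒≡ (∧-conicalʳ (y == u) _ e₃)))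

  deleted-matching : ∀ x y z → y ≢ z → Deleted x y → Deleted x z → ⊥
  deleted-matching x y z ne (inj₁ (a , e)) (inj₁ (b , e')) = col-proper (col-ok S) x y z a b ne (trans e (sym e'))
  deleted-matching x y z ne (inj₁ (a , _)) (inj₂ (inj₁ (x≡u , _))) = adj⁻⇒≢₁ G u a x≡u
  deleted-matching x y z ne (inj₁ (a , e)) (inj₂ (inj₂ (_ , refl))) = v-misses-α y a e
  deleted-matching x y z ne (inj₂ (inj₁ (x≡u , _))) (inj₁ (b , _)) = adj⁻⇒≢₁ G u b x≡u
  deleted-matching x y z ne (inj₂ (inj₂ (_ , refl))) (inj₁ (b , e)) = v-misses-α z b e
  deleted-matching x y z ne (inj₂ (inj₁ (_ , y≡v))) (inj₂ (inj₁ (_ , z≡v))) = ne (trans y≡v (sym z≡v))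
  deleted-matching x y z ne (inj₂ (inj₁ (x≡u , _))) (inj₂ (inj₂ (_ , x≡v))) = adj⇒≢ G uv-edge (trans (sym x≡u) x≡v)
  deleted-matching x y z ne (inj₂ (inj₂ (_ , x≡v))) (inj₂ (inj₁ (x≡u , _))) = adj⇒≢ G uv-edge (trans (sym x≡u) x≡v)
  deleted-matching x y z ne (inj₂ (inj₂ (y≡u , _))) (inj₂ (inj₂ (z≡u , _))) = ne (trans y≡u (sym z≡u))

  extend : Colouring Gα k' → Colouring G (suc k')
  extend (c₀ , P₀) = colour , record { col-sym = symmetric ; col-proper = proper ; col-bound = bound }
    where
    colour : Fin (n G) → Fin (n G) → ℕ
    colour x y = if deleted x y then α else unsqueeze α (c₀ x y)
    colour-deleted : ∀ {x y} → deleted x y ≡ true → colour x y ≡ α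
    colour-deleted e rewrite e = refl
    colour-kept : ∀ {x y} → deleted x y ≡ false → colour x y ≡ unsqueeze α (c₀ x y)
    colour-kept e rewrite e = refl
    symmetric : ∀ x y → adj G x y ≡ true → colour x y ≡ colour y x
    symmetric x y a with bool-cases (deleted x y)
    ... | inj₁ e = trans (colour-deleted e) (sym (colour-deleted (trans (deleted-sym y x) e)))
    ... | inj₂ e = trans (colour-kept e) (trans (cong (unsqueeze α) (col-sym P₀ x y (Gα-edge-intro a e)))
                     (sym (colour-kept (trans (deleted-sym y x) e))))
    proper : ∀ x y z → adj G x y ≡ true → adj G x z ≡ true → y ≢ z → colour x y ≢ colour x z
    proper x y z a b ne with bool-cases (deleted x y) | bool-cases (deleted x z)
    ... | inj₁ e | inj₁ e' = λ _ → deleted-matching x y z ne (deleted⇒ x y e) (deleted⇒ x z e')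
    ... | inj₁ e | inj₂ e' = λ eq → unsqueeze≢ α (c₀ x z) (sym (trans (sym (colour-deleted e)) (trans eq (colour-kept e'))))
    ... | inj₂ e | inj₁ e' = λ eq → unsqueeze≢ α (c₀ x y) (trans (sym (colour-kept e)) (trans eq (colour-deleted e')))
    ... | inj₂ e | inj₂ e' = λ eq → col-proper P₀ x y z (Gα-edge-intro a e) (Gα-edge-intro b e') ne
                                     (unsqueeze-injective α _ _ (trans (sym (colour-kept e)) (trans eq (colour-kept e'))))
    bound : ∀ x y → adj G x y ≡ true → colour x y < suc k'
    bound x y a with bool-cases (deleted x y)
    ... | inj₁ e rewrite colour-deleted {x} {y} e = α<k
    ... | inj₂ e rewrite colour-kept {x} {y} e = unsqueeze-bound α (c₀ x y) α<k (col-bound P₀ x y (Gα-edge-intro a e))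

  result : Colouring G (suc k')
  result = extend (IH Gα u reduced)

even : ℕ → Bool
even zero = true
even (suc i) = not (even i)

even-suc-suc : ∀ i → even (suc (suc i)) ≡ even i
even-suc-suc i = not-involutive (even i)

even-+ : ∀ m k → even (m + k) ≡ (if even m then even k else not (even k))
even-+ zero k = refl
even-+ (suc m) k rewrite even-+ m k with even m
... | true = refl
... | false = not-involutive (even k)

-- Fix a proper colouring c of G - u and two distinct colours α, β.  Every
-- vertex has at most one edge of each colour, so from a vertex a missing α
-- there is exactly one walk that uses edges coloured β, α, β, α, … in turn.
-- It never repeats a vertex, hence stops within n steps; its vertices form
-- the Kempe chain of a.  Interchanging α and β on that chain keeps the
-- colouring proper.
module KempeChain (G : Graph) (u : Fin (n G)) {k : ℕ} (c : Fin (n G) → Fin (n G) → ℕ)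
  (P : IsProper (adj⁻ G u) k c) (α β : ℕ) (α≢β : α ≢ β) where

  N : ℕ
  N = n G

  V : Set
  V = Fin N

  via : ℕ → V → Maybe V
  via γ x = find (λ y → adj⁻ G u x y ∧ (c x y =ℕ γ))

  via-just : ∀ γ {x y} → via γ x ≡ just y → adj⁻ G u x y ≡ true × c x y ≡ γ
  via-just γ {x} {y} e = let h = find-just (λ y → adj⁻ G u x y ∧ (c x y =ℕ γ)) e
                         in ∧-conicalˡ _ _ h , =ℕ⇒≡ (∧-conicalʳ (adj⁻ G u x y) _ h)

  via-nothing : ∀ γ {x} → via γ x ≡ nothing → ∀ y → adj⁻ G u x y ≡ true → c x y ≢ γ
  via-nothing γ {x} e y a ce = false≢true (find-nothing (λ y → adj⁻ G u x y ∧ (c x y =ℕ γ)) e y)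
                                          (∧-intro a (≡⇒=ℕ ce))

  -- Colour classes are matchings: the γ-edge at x is the only one.
  via-edge : ∀ γ {x y} → adj⁻ G u x y ≡ true → c x y ≡ γ → via γ x ≡ just y
  via-edge γ {x} {y} a ce with via γ x in eq
  ... | nothing = ⊥-elim (via-nothing γ eq y a ce)
  ... | just y' with y' ≟F y
  ...   | yes e = cong just e
  ...   | no ne = let (a' , ce') = via-just γ eq in
                  ⊥-elim (col-proper P x y' y a' a ne (trans ce' (sym ce)))

  via-back : ∀ γ {x y} → via γ x ≡ just y → via γ y ≡ just x
  via-back γ {x} {y} e = let (a , ce) = via-just γ e in
    via-edge γ (trans (adj⁻-sym G u y x) a) (trans (sym (col-sym P x y a)) ce)

  via-irrefl : ∀ γ {x} → via γ x ≢ just x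
  via-irrefl γ {x} e = false≢true (adj-irrefl G x) (adj⁻⇒adj G u (proj₁ (via-just γ e)))

  α-free : V → Set
  α-free a = via α a ≡ nothing

  colourOf : Bool → ℕ
  colourOf true = β
  colourOf false = α

  step : ℕ → V → Maybe V
  step i = via (colourOf (even i))

  walk : V → ℕ → Maybe V
  walk a zero = just a
  walk a (suc i) with walk a i
  ... | just x = step i x
  ... | nothing = nothing

  walk-back : ∀ a i {y} → walk a (suc i) ≡ just y → ∃ λ x → walk a i ≡ just x × step i x ≡ just y
  walk-back a i e with walk a i
  ... | just x = x , refl , e

  walk-forward : ∀ a i {x} → walk a i ≡ just x → walk a (suc i) ≡ step i x
  walk-forward a i e rewrite e = refl

  walk-stopped : ∀ a i j → walk a i ≡ nothing → i ≤ j → walk a j ≡ nothing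
  walk-stopped a i j e le with m≤n⇒m<n∨m≡n le
  ... | inj₂ refl = e
  walk-stopped a i (suc j) e le | inj₁ lt rewrite walk-stopped a i j e (s≤s⁻¹ lt) = refl

  walk-defined : ∀ a i j {y} → walk a j ≡ just y → i ≤ j → ∃ λ x → walk a i ≡ just x
  walk-defined a i j e le with walk a i in eq
  ... | just x = x , refl
  ... | nothing = ⊥-elim (nothing≢just (trans (sym (walk-stopped a i j eq le)) e))

  -- A repeat at
  -- steps i+1 < j+1 arrives through the edges of steps i and j; if these
  -- have the same colour the repeat moves back to steps i < j, otherwise it
  -- moves forward to steps i+2 ≤ j, and i+2 = j is excluded by parity.  A
  -- return to the start a arrives through a β-edge (a is α-free), which is
  -- also the first edge of the walk: a repeat at steps 1 < j.
  walk-injective : ∀ a → α-free a → ∀ j i {z} → i < j → walk a i ≡ just z → walk a j ≡ just z → ⊥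
  walk-injective a free (suc j) i lt wi wj with walk-back a j wj
  walk-injective a free (suc j) zero lt refl wj | x , wx , sx with even j in ej
  ... | false = nothing≢just (trans (sym free) (via-back α sx))
  ... | true = back-to-first j ej wx (via-back β sx)
    where
    back-to-first : ∀ j → even j ≡ true → walk a j ≡ just x → step 0 a ≡ just x → ⊥
    back-to-first zero _ w₀ s₀ with just-injective w₀
    ... | refl = via-irrefl β s₀
    back-to-first (suc zero) () _ _
    back-to-first (suc (suc j)) _ wj s₀ = walk-injective a free (suc (suc j)) 1 (s≤s (s≤s z≤n)) s₀ wj
  walk-injective a free (suc j) (suc i) {z} lt wi wj | x , wx , sx with walk-back a i wi
  ... | x' , wx' , sx' with even i ≟B even j
  ...   | yes same = walk-injective a free j i (s≤s⁻¹ lt) (subst (λ w → walk a i ≡ just w) x'≡x wx') wx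
    where
    x'≡x : x' ≡ x
    x'≡x = just-injective (trans (sym (via-back _ sx')) (trans (cong (λ b → via (colourOf b) z) same) (via-back _ sx)))
  ...   | no differ with <-cmp (suc (suc i)) j
  ...     | tri< l _ _ = walk-injective a free j (suc (suc i)) l ahead wx
    where
    ahead : walk a (suc (suc i)) ≡ just x
    ahead = trans (walk-forward a (suc i) wi)
              (trans (cong (λ b → via (colourOf b) z) (≢⇒not (even i) (even j) differ)) (via-back _ sx))
  ...     | tri≈ _ e _ = differ (trans (sym (even-suc-suc i)) (cong even e))
  ...     | tri> _ _ g = via-irrefl (colourOf (even j)) (subst (λ w → via (colourOf (even j)) z ≡ just w) x≡z (via-back _ sx))
    where
    x≡z : x ≡ z
    x≡z = just-injective (trans (sym wx) (trans (cong (walk a) (≤-antisym (s≤s⁻¹ g) (s≤s⁻¹ lt))) wi))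

  -- By the pigeonhole principle the walk has stopped after n steps.
  walk-terminates : ∀ a → α-free a → walk a N ≡ nothing
  walk-terminates a free with walk a N in eq
  ... | nothing = refl
  ... | just y = ⊥-elim (repeated (pigeonhole (n<1+n N) position))
    where
    position : Fin (suc N) → V
    position i = fromMaybe a (walk a (toℕ i))
    position-visits : ∀ i → walk a (toℕ i) ≡ just (position i)
    position-visits i with walk-defined a (toℕ i) N eq (s≤s⁻¹ (toℕ<n i))
    ... | x , e rewrite e = refl
    repeated : (∃ λ i → ∃ λ j → toℕ i < toℕ j × position i ≡ position j) → ⊥
    repeated (i , j , lt , same) = walk-injective a free (toℕ j) (toℕ i) lt (position-visits i)
                                     (trans (position-visits j) (cong just (sym same)))

  visitedBefore : V → V → ℕ → Bool
  visitedBefore a z zero = false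
  visitedBefore a z (suc t) = visitedAt (walk a t) ∨ visitedBefore a z t
    where
    visitedAt : Maybe V → Bool
    visitedAt (just x) = x == z
    visitedAt nothing = false

  inChain : V → V → Bool
  inChain a z = visitedBefore a z N

  inChain-elim : ∀ a z → inChain a z ≡ true → ∃ λ t → walk a t ≡ just z
  inChain-elim a z = go N
    where
    go : ∀ m → visitedBefore a z m ≡ true → ∃ λ t → walk a t ≡ just z
    go (suc m) e with walk a m in eq
    ... | nothing = go m e
    ... | just x with x == z in x=z
    ...   | true = m , trans eq (cong just (==⇒≡ x=z))
    ...   | false = go m e

  inChain-intro : ∀ a → α-free a → ∀ z t → walk a t ≡ just z → inChain a z ≡ true
  inChain-intro a free z t e with t <? N
  ... | yes lt = go t N e lt
    where
    go : ∀ t m → walk a t ≡ just z → t < m → visitedBefore a z m ≡ true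
    go t (suc m) e lt with m≤n⇒m<n∨m≡n (s≤s⁻¹ lt)
    ... | inj₂ refl rewrite e = ∨-intro₁ (==-refl z)
    ... | inj₁ l = ∨-intro₂ (go t m e l)
  ... | no nl = ⊥-elim (nothing≢just (trans (sym (walk-stopped a N t (walk-terminates a free) (≮⇒≥ nl))) e))

  inChain-start : ∀ a → α-free a → inChain a a ≡ true
  inChain-start a free = inChain-intro a free a 0 refl

  previous-colour : ∀ t γ → (γ ≡ α ⊎ γ ≡ β) → γ ≢ colourOf (even (suc t)) → γ ≡ colourOf (even t)
  previous-colour t γ αβ ne with even t | αβ
  ... | true | inj₁ e = ⊥-elim (ne e)
  ... | true | inj₂ e = e
  ... | false | inj₁ e = e
  ... | false | inj₂ e = ⊥-elim (ne e)

  chain-closed : ∀ a → α-free a → ∀ z y γ → (γ ≡ α ⊎ γ ≡ β) →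
                 inChain a z ≡ true → via γ z ≡ just y → inChain a y ≡ true
  chain-closed a free z y γ αβ in-z zy with inChain-elim a z in-z
  ... | t , wt with γ ≟ colourOf (even t)
  ...   | yes e = inChain-intro a free y (suc t) (trans (walk-forward a t wt) (trans (cong (λ g → via g z) (sym e)) zy))
  ...   | no ne with t | αβ
  ...     | zero | inj₁ refl with just-injective wt
  ...       | refl = ⊥-elim (nothing≢just (trans (sym free) zy))
  chain-closed a free z y γ αβ in-z zy | t , wt | no ne | zero | inj₂ e = ⊥-elim (ne e)
  chain-closed a free z y γ αβ in-z zy | t , wt | no ne | suc t' | _ with walk-back a t' wt
  ... | x , wx , sx = inChain-intro a free y t' (trans wx (cong just (sym y≡x)))
    where
    y≡x : y ≡ x
    y≡x = just-injective (trans (sym zy) (trans (cong (λ g → via g z) (previous-colour t' γ αβ ne)) (via-back _ sx)))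

  -- An α-free vertex reached after i > 0 steps was entered through a β-edge
  -- (i is odd) and the walk stops there.
  α-free-stop : ∀ a i z → walk a i ≡ just z → α-free z → i ≢ 0 → even i ≡ false × walk a (suc i) ≡ nothing
  α-free-stop a zero z w free-z nz = ⊥-elim (nz refl)
  α-free-stop a (suc i) z w free-z nz with walk-back a i w
  ... | x , wx , sx with even i in ei
  ...   | false = ⊥-elim (nothing≢just (trans (sym free-z) (via-back α sx)))
  ...   | true = refl , trans (walk-forward a (suc i) w) (trans (cong (λ b → via (colourOf (not b)) z) ei) free-z)

  walk-reverse : ∀ a j b → walk a j ≡ just b → even j ≡ false → ∀ t r → t + r ≡ j → walk b t ≡ walk a r
  walk-reverse a j b wb odd zero r e = trans (sym wb) (cong (walk a) (sym e))
  walk-reverse a j b wb odd (suc t) r e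
    with walk-defined a (suc r) j wb (subst (suc r ≤_) (trans (+-suc t r) e) (m≤n+m (suc r) t))
  ... | y , wy with walk-back a r wy
  ...   | x , wx , sx = begin
    walk b (suc t)                   ≡⟨ walk-forward b t (trans previous wy) ⟩
    via (colourOf (even t)) y        ≡⟨ cong (λ g → via (colourOf g) y) same-parity ⟩
    via (colourOf (even r)) y        ≡⟨ via-back _ sx ⟩
    just x                           ≡⟨ wx ⟨
    walk a r                         ∎
    where
    open ≡-Reasoning
    e' : t + suc r ≡ j
    e' = trans (+-suc t r) e
    previous : walk b t ≡ walk a (suc r)
    previous = walk-reverse a j b wb odd t (suc r) e'
    same-parity : even t ≡ even r
    same-parity = from-odd-sum (even t) (even r) (trans (sym (even-+ t (suc r))) (trans (cong even e') odd))
      where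
      from-odd-sum : ∀ p q → (if p then not q else not (not q)) ≡ false → p ≡ q
      from-odd-sum true true _ = refl
      from-odd-sum false false _ = refl
      from-odd-sum true false ()
      from-odd-sum false true ()

  -- The walk from a reaches b after an odd
  -- number of steps and stops there; the walk from b is the same walk
  -- reversed, and an α-free vertex strictly inside would have stopped it.
  chain-pairs : ∀ a b → α-free a → α-free b → inChain a b ≡ true → b ≢ a →
                ∀ w → inChain b w ≡ true → α-free w → w ≡ b ⊎ w ≡ a
  chain-pairs a b free-a free-b ab b≢a w bw free-w with inChain-elim a b ab
  ... | zero , wj = ⊥-elim (b≢a (sym (just-injective wj)))
  ... | suc j , wj with α-free-stop a (suc j) b wj free-b (λ ())
  ...   | odd , _ with inChain-elim b w bw
  ...     | t , wt with t ≤? suc j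
  ...       | no t>j = ⊥-elim (nothing≢just (trans (sym (walk-stopped b (suc (suc j)) t b-stops (≰⇒> t>j))) wt))
    where
    b-stops : walk b (suc (suc j)) ≡ nothing
    b-stops = trans (walk-forward b (suc j) (walk-reverse a (suc j) b wj odd (suc j) 0 (+-identityʳ _)))
                    (trans (cong (λ g → via (colourOf g) a) odd) free-a)
  ...       | yes t≤j = by-position t (suc j ∸ t) (m+[n∸m]≡n t≤j)
                          (trans (sym (walk-reverse a (suc j) b wj odd t (suc j ∸ t) (m+[n∸m]≡n t≤j))) wt) wt
    where
    by-position : ∀ t r → t + r ≡ suc j → walk a r ≡ just w → walk b t ≡ just w → w ≡ b ⊎ w ≡ a
    by-position zero r e war wbt = inj₁ (just-injective (sym wbt))
    by-position (suc t) zero e war wbt = inj₂ (just-injective (sym war))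
    by-position (suc t) (suc r) e war wbt =
      let (_ , stops) = α-free-stop a (suc r) w war free-w (λ ())
          (_ , continues) = walk-defined a (suc (suc r)) (suc j) wj
                              (subst (suc (suc r) ≤_) e (s≤s (m≤n+m (suc r) t)))
      in ⊥-elim (nothing≢just (trans (sym stops) continues))

  open Transposition α β α≢β public

  module SwapChain (a : V) (free : α-free a) where

    swapped : V → V → ℕ
    swapped x y = if inChain a x then swap (c x y) else c x y

    swapped-in : ∀ {x} y → inChain a x ≡ true → swapped x y ≡ swap (c x y)
    swapped-in y e rewrite e = refl

    swapped-out : ∀ {x} y → inChain a x ≡ false → swapped x y ≡ c x y
    swapped-out y e rewrite e = refl

    -- An edge leaving the chain has a colour other than α and β.
    leaving-edge : ∀ x y → adj⁻ G u x y ≡ true → inChain a x ≡ true → inChain a y ≡ false → swap (c x y) ≡ c x y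
    leaving-edge x y a⁻ in-x out-y = swap-other (c x y)
      (λ e → false≢true out-y (chain-closed a free x y α (inj₁ refl) in-x (via-edge α a⁻ e)))
      (λ e → false≢true out-y (chain-closed a free x y β (inj₂ refl) in-x (via-edge β a⁻ e)))

    swapped-sym : ∀ x y → adj⁻ G u x y ≡ true → swapped x y ≡ swapped y x
    swapped-sym x y a⁻ with bool-cases (inChain a x) | bool-cases (inChain a y)
    ... | inj₁ ix | inj₁ iy = trans (swapped-in y ix) (trans (cong swap (col-sym P x y a⁻)) (sym (swapped-in x iy)))
    ... | inj₂ ix | inj₂ iy = trans (swapped-out y ix) (trans (col-sym P x y a⁻) (sym (swapped-out x iy)))
    ... | inj₁ ix | inj₂ iy = trans (swapped-in y ix) (trans (leaving-edge x y a⁻ ix iy)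
                                (trans (col-sym P x y a⁻) (sym (swapped-out x iy))))
    ... | inj₂ ix | inj₁ iy = trans (swapped-out y ix) (trans (col-sym P x y a⁻)
                                (trans (sym (leaving-edge y x (trans (adj⁻-sym G u y x) a⁻) iy ix)) (sym (swapped-in x iy))))

    swapped-proper : ∀ x y z → adj⁻ G u x y ≡ true → adj⁻ G u x z ≡ true → y ≢ z → swapped x y ≢ swapped x z
    swapped-proper x y z a₁ a₂ ne e with bool-cases (inChain a x)
    ... | inj₁ ix = col-proper P x y z a₁ a₂ ne (swap-injective _ _ (trans (sym (swapped-in y ix)) (trans e (swapped-in z ix))))
    ... | inj₂ ix = col-proper P x y z a₁ a₂ ne (trans (sym (swapped-out y ix)) (trans e (swapped-out z ix)))

count-remove : ∀ {n} (P : Fin n → Bool) a → P a ≡ true → count P ≡ suc (count (λ i → P i ∧ not (i == a)))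
count-remove P a pa = trans (sum-split (ind ∘ P) a) (cong₂ _+_ (cong ind pa) (sum-cong-≗ pointwise))
  where
  pointwise : ∀ i → ((ind ∘ P) ∖ a) i ≡ ind (P i ∧ not (i == a))
  pointwise i with i == a | P i
  ... | true  | true  = refl
  ... | true  | false = refl
  ... | false | true  = refl
  ... | false | false = refl

involution-even : ∀ {n} (P : Fin n → Bool) (f : Fin n → Fin n) →
  (∀ a → P a ≡ true → P (f a) ≡ true × f (f a) ≡ a × f a ≢ a) → Even (count P)
involution-even {n} P f inv = go (count P) P inv refl
  where
  go : ∀ m P → (∀ a → P a ≡ true → P (f a) ≡ true × f (f a) ≡ a × f a ≢ a) → count P ≡ m → Even m
  go zero P inv e = 0 , refl
  go (suc m) P inv e with count-pos⇒find P (subst (1 ≤_) (sym e) (s≤s z≤n))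
  ... | a , _ , pa = by-size m e'
    where
    b : Fin n
    b = f a
    Pa P' : Fin n → Bool
    Pa i = P i ∧ not (i == a)
    P' i = Pa i ∧ not (i == b)
    pb : P b ≡ true
    pb = proj₁ (inv a pa)
    b≢a : b ≢ a
    b≢a = proj₂ (proj₂ (inv a pa))
    e' : suc m ≡ suc (suc (count P'))
    e' = trans (sym e) (trans (count-remove P a pa)
           (cong suc (count-remove Pa b (∧-intro pb (cong not (≢⇒==-false b≢a))))))
    inv' : ∀ x → P' x ≡ true → P' (f x) ≡ true × f (f x) ≡ x × f x ≢ x
    inv' x px =
      let x≢a = ==-false⇒≢ (not-injective (∧-conicalʳ (P x) _ (∧-conicalˡ _ _ px)))
          x≢b = ==-false⇒≢ (not-injective (∧-conicalʳ (Pa x) _ px))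
          (pfx , ffx , fx≢x) = inv x (∧-conicalˡ _ _ (∧-conicalˡ _ _ px))
          fx≢a : f x ≢ a
          fx≢a e = x≢b (trans (sym ffx) (cong f e))
          fx≢b : f x ≢ b
          fx≢b e = x≢a (trans (sym ffx) (trans (cong f e) (proj₁ (proj₂ (inv a pa)))))
      in ∧-intro (∧-intro pfx (cong not (≢⇒==-false fx≢a))) (cong not (≢⇒==-false fx≢b)) ,
         ffx , fx≢x
    by-size : ∀ m → suc m ≡ suc (suc (count P')) → Even (suc m)
    by-size zero ()
    by-size (suc m) e with go m P' inv' (suc-injective (suc-injective (sym e)))
    ... | h , refl = suc h , cong suc (sym (+-suc h h))

one-less-than-double-odd : ∀ m d → d ≢ 0 → m + 1 ≡ d + d → Odd m
one-less-than-double-odd m zero nz e = ⊥-elim (nz refl)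
one-less-than-double-odd m (suc h) _ e =
  h , +-cancelʳ-≡ 1 m _ (trans e (cong suc (trans (+-suc h h) (+-comm 1 (h + h)))))

odd? : ∀ m → Dec (Odd m)
odd? m with even-or-odd m
... | inj₁ ev = no (λ od → odd⇒¬even od ev)
... | inj₂ od = yes od

odd-total : ∀ {K} (f : Fin K → ℕ) → Odd (sum f) → sum f < K + K →
  (∃ λ γ → f γ ≡ 1) ⊎ ((∃ λ α → Odd (f α)) × (∃ λ β → f β ≡ 0))
odd-total {K} f odd lt with any? (λ γ → f γ ≤? 1)
... | no none = ⊥-elim (<⇒≱ lt (begin
      K + K      ≡⟨ cong (K +_) (sym (+-identityʳ K)) ⟩
      K + (K + 0) ≡⟨ *-comm 2 K ⟩
      K * 2      ≡⟨ sum-const {K} 2 ⟨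
      sum {K} (λ _ → 2) ≤⟨ sum-mono (λ γ → ≰⇒> (λ le → none (γ , le))) ⟩
      sum f      ∎))
  where open ≤-Reasoning
... | yes (β , fβ≤1) with f β in eβ | fβ≤1
...   | suc (suc _) | s≤s ()
...   | suc zero | _ = inj₁ (β , eβ)
...   | zero | _ with any? (λ γ → odd? (f γ))
...     | yes α-odd = inj₂ (α-odd , (β , eβ))
...     | no none = ⊥-elim (odd⇒¬even odd (sum-even f all-even))
  where
  all-even : ∀ γ → Even (f γ)
  all-even γ with even-or-odd (f γ)
  ... | inj₁ ev = ev
  ... | inj₂ od = ⊥-elim (none (γ , od))

-- If α is a spare colour of an odd number of neighbours of u and β of none,
-- some α-spare neighbour a is the only α-spare neighbour in its α/β Kempe
-- chain (otherwise "the other α-spare neighbour in the chain" would pair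
-- them up, making their number even).  Interchanging α and β on the chain
-- of a makes β a spare colour of a and of no other neighbour.
module KempeInterchange {k} (G : Graph) (u : Fin (n G)) (S : Config k G u) (α β : ℕ) (β<k : β < k)
  (β-unused : ∀ w → adj G u w ≡ true → spare S w β ≡ false)
  (α-odd : Odd (count (λ w → adj G u w ∧ spare S w α))) where

  αSpare : Fin (n G) → Bool
  αSpare w = adj G u w ∧ spare S w α

  α≢β : α ≢ β
  α≢β refl = odd⇒¬even α-odd (0 , trans (sum-cong-≗ none) (sum-replicate-zero (n G)))
    where
    none : ∀ w → ind (adj G u w ∧ spare S w β) ≡ 0
    none w with bool-cases (adj G u w)
    ... | inj₁ a rewrite a | β-unused w a = refl
    ... | inj₂ a rewrite a = refl

  open KempeChain G u (col S) (col-ok S) α β α≢β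

  αSpare⇒α-free : ∀ w → αSpare w ≡ true → α-free w
  αSpare⇒α-free w sw with via α w in eq
  ... | nothing = refl
  ... | just y = let (a⁻ , cy) = via-just α eq in
      ⊥-elim (proj₁ (spare-misses S w α (∧-conicalˡ _ _ sw) (∧-conicalʳ (adj G u w) _ sw)) y a⁻ cy)

  partner : Fin (n G) → Maybe (Fin (n G))
  partner a = find (λ w → (inChain a w ∧ αSpare w) ∧ not (w == a))

  lonely : Fin (n G) → Set
  lonely a = αSpare a ≡ true × partner a ≡ nothing

  lonely-alone : ∀ a → lonely a → ∀ w → inChain a w ≡ true → αSpare w ≡ true → w ≡ a
  lonely-alone a (_ , none) w iw sw =
    ==⇒≡ (not-injective (∧-false (find-nothing (λ w → (inChain a w ∧ αSpare w) ∧ not (w == a)) none w)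
                              (∧-intro iw sw)))

  module Interchange (a : Fin (n G)) (alone : lonely a) where
    sa : αSpare a ≡ true
    sa = proj₁ alone

    free : α-free a
    free = αSpare⇒α-free a sa

    open SwapChain a free

    α<k : α < k
    α<k = proj₂ (spare-misses S a α (∧-conicalˡ _ _ sa) (∧-conicalʳ (adj G u a) _ sa))

    at : Fin (n G) → ℕ → ℕ
    at w γ = if inChain a w then swap γ else γ

    at-injective : ∀ w x y → at w x ≡ at w y → x ≡ y
    at-injective w x y e with inChain a w
    ... | true = swap-injective x y e
    ... | false = e

    at-bound : ∀ w γ → γ < k → at w γ < k
    at-bound w γ γk with inChain a w
    ... | true = swap-bound γ α<k β<k γk
    ... | false = γk

    at-=ℕ : ∀ w x γ → (at w x =ℕ γ) ≡ (x =ℕ at w γ)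
    at-=ℕ w x γ with inChain a w
    ... | true = swap-=ℕ x γ
    ... | false = refl

    at-misses : ∀ w γ → Misses G u (col S) w γ → Misses G u swapped w (at w γ)
    at-misses w γ m x a⁻ e = m x a⁻ (at-injective w (col S w x) γ e)

    interchanged : Config k G u
    interchanged = record
      { col       = swapped
      ; col-ok    = record { col-sym = swapped-sym ; col-proper = swapped-proper
                           ; col-bound = λ x y a⁻ → at-bound x (col S x y) (col-bound (col-ok S) x y a⁻) }
      ; special   = special S
      ; miss₁     = λ w → at w (miss₁ S w)
      ; miss₂     = λ w → at w (miss₂ S w)
      ; miss₁-ok  = λ w aw → let (m , b) = miss₁-ok S w aw in at-misses w _ m , at-bound w _ b
      ; miss₂-ok  = λ w aw ns → let (m , b , p≢q) = miss₂-ok S w aw ns in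
                      at-misses w _ m , at-bound w _ b , (λ e → p≢q (at-injective w _ _ e))
      ; deg-bound = deg-bound S
      }

    spare-interchanged : ∀ w γ → spare interchanged w γ ≡ spare S w (at w γ)
    spare-interchanged w γ = cong₂ _∨_ (at-=ℕ w (miss₁ S w) γ)
                                       (cong (not (w == special S) ∧_) (at-=ℕ w (miss₂ S w) γ))

    β-unique : UniqueSpare G u interchanged a β
    β-unique = ∧-conicalˡ _ _ sa , a-spare , others
      where
      a-spare : spare interchanged a β ≡ true
      a-spare rewrite spare-interchanged a β | inChain-start a free | swap-β = ∧-conicalʳ (adj G u a) _ sa
      others : ∀ w → adj G u w ≡ true → w ≢ a → spare interchanged w β ≡ false
      others w aw w≢a rewrite spare-interchanged w β with bool-cases (inChain a w)
      ... | inj₂ out rewrite out = β-unused w aw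
      ... | inj₁ in-w rewrite in-w | swap-β with bool-cases (spare S w α)
      ...   | inj₁ sα = ⊥-elim (w≢a (lonely-alone a alone w in-w (∧-intro aw sα)))
      ...   | inj₂ sα = sα

  result : Σ (Config k G u) λ S' → Σ (Fin (n G)) λ v → UniqueSpare G u S' v β
  result with any? (λ a → lonely? a)
    where
    lonely? : ∀ a → Dec (lonely a)
    lonely? a with αSpare a ≟B true | partner a
    ... | yes sa | nothing = yes (sa , refl)
    ... | yes _ | just _ = no (λ { (_ , ()) })
    ... | no ns | _ = no (λ l → ns (proj₁ l))
  ... | yes (a , alone) = Interchange.interchanged a alone , a , Interchange.β-unique a alone
  ... | no none = ⊥-elim (odd⇒¬even α-odd (involution-even αSpare other pairing))
    where
    -- With no lonely vertex, mapping each α-spare neighbour to the other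
    -- α-spare neighbour of its chain is a fixed-point-free involution.
    other : Fin (n G) → Fin (n G)
    other a = fromMaybe a (partner a)
    other-spec : ∀ a → αSpare a ≡ true → inChain a (other a) ≡ true × αSpare (other a) ≡ true × other a ≢ a
    other-spec a sa with partner a in eq
    ... | nothing = ⊥-elim (none (a , sa , eq))
    ... | just w = let h = find-just (λ w → (inChain a w ∧ αSpare w) ∧ not (w == a)) eq
                   in ∧-conicalˡ _ _ (∧-conicalˡ _ _ h) , ∧-conicalʳ (inChain a w) _ (∧-conicalˡ _ _ h) ,
                      ==-false⇒≢ (not-injective (∧-conicalʳ (inChain a w ∧ αSpare w) _ h))
    pairing : ∀ a → αSpare a ≡ true → αSpare (other a) ≡ true × other (other a) ≡ a × other a ≢ a
    pairing a sa =
      let (i₁ , s₁ , n₁) = other-spec a sa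
          (i₂ , s₂ , n₂) = other-spec (other a) s₁
      in s₁ , back (chain-pairs a (other a) (αSpare⇒α-free a sa) (αSpare⇒α-free _ s₁) i₁ n₁
                                (other (other a)) i₂ (αSpare⇒α-free _ s₂)) n₂ , n₁
      where
      back : ∀ {x y z : Fin (n G)} → x ≡ y ⊎ x ≡ z → x ≢ y → x ≡ z
      back (inj₁ e) ne = ⊥-elim (ne e)
      back (inj₂ e) ne = e

count-colour : ∀ {K} a → a < K → count {K} (λ γ → a =ℕ toℕ γ) ≡ 1
count-colour {K} a lt = trans (sum-cong-≗ pointwise) (sum-point (fromℕ< lt) 1)
  where
  pointwise : ∀ γ → ind (a =ℕ toℕ γ) ≡ (if γ == fromℕ< lt then 1 else 0)
  pointwise γ with γ ≟F fromℕ< lt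
  ... | yes refl rewrite toℕ-fromℕ< lt | =ℕ-refl a = refl
  ... | no ne rewrite ≢⇒=ℕ-false {a} {toℕ γ} (λ e → ne (toℕ-injective (trans (sym e) (sym (toℕ-fromℕ< lt))))) = refl

-- Counting pairs (neighbour w, spare colour γ of w) in two ways, when the
-- special neighbour is a neighbour of u.
module SpareCount {k} (G : Graph) (u : Fin (n G)) (S : Config k G u) (special-adj : adj G u (special S) ≡ true) where

  holder : ℕ → Fin (n G) → Bool
  holder γ w = adj G u w ∧ spare S w γ

  holders : ℕ → ℕ
  holders γ = count (holder γ)

  holders< : Fin k → ℕ
  holders< γ = holders (toℕ γ)

  d : ℕ
  d = count (adj G u)

  spares-at : ∀ w → count {k} (λ γ → adj G u w ∧ spare S w (toℕ γ)) ≡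
                    (if adj G u w then (if w == special S then 1 else 2) else 0)
  spares-at w with bool-cases (adj G u w)
  ... | inj₂ a rewrite a = sum-replicate-zero k
  ... | inj₁ a rewrite a with bool-cases (w == special S)
  ...   | inj₁ ws rewrite ws =
          trans (sum-cong-≗ {k} (λ γ → cong ind (∨-identityʳ (miss₁ S w =ℕ toℕ γ))))
                (count-colour (miss₁ S w) (proj₂ (miss₁-ok S w a)))
  ...   | inj₂ ws rewrite ws =
          let (_ , q<k , p≢q) = miss₂-ok S w a (==-false⇒≢ ws) in
          trans (sum-cong-≗ {k} (λ γ → ind-∨ (miss₁ S w =ℕ toℕ γ) (miss₂ S w =ℕ toℕ γ)
                   (λ e₁ e₂ → p≢q (trans (=ℕ⇒≡ e₁) (sym (=ℕ⇒≡ e₂))))))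
          (trans (∑-distrib-+ {k} (λ γ → ind (miss₁ S w =ℕ toℕ γ)) (λ γ → ind (miss₂ S w =ℕ toℕ γ)))
                 (cong₂ _+_ (count-colour (miss₁ S w) (proj₂ (miss₁-ok S w a))) (count-colour (miss₂ S w) q<k)))

  total : sum holders< + 1 ≡ d + d
  total = begin
    sum holders< + 1                ≡⟨ cong (_+ 1) (∑-comm {k} {n G} (λ γ w → ind (adj G u w ∧ spare S w (toℕ γ)))) ⟩
    sum (λ w → count {k} (λ γ → adj G u w ∧ spare S w (toℕ γ))) + 1
                                           ≡⟨ cong (_+ 1) (sum-cong-≗ spares-at) ⟩
    sum g + 1                              ≡⟨ cong (_+ 1) (sum-split g (special S)) ⟩
    (g (special S) + sum (g ∖ special S)) + 1 ≡⟨ cong (λ z → (z + sum (g ∖ special S)) + 1) g-special ⟩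
    suc (sum (g ∖ special S)) + 1          ≡⟨ +-comm (suc (sum (g ∖ special S))) 1 ⟩
    2 + sum (g ∖ special S)                ≡⟨ cong (2 +_) (sum-cong-≗ twice-elsewhere) ⟩
    2 + sum (dd ∖ special S)               ≡⟨ cong (_+ sum (dd ∖ special S)) dd-special ⟨
    dd (special S) + sum (dd ∖ special S)  ≡⟨ sum-split dd (special S) ⟨
    sum dd                                 ≡⟨ ∑-distrib-+ (ind ∘ adj G u) (ind ∘ adj G u) ⟩
    d + d                                  ∎
    where
    open ≡-Reasoning
    g : Fin (n G) → ℕ
    g w = if adj G u w then (if w == special S then 1 else 2) else 0
    dd : Fin (n G) → ℕ
    dd w = ind (adj G u w) + ind (adj G u w)
    g-special : g (special S) ≡ 1
    g-special rewrite special-adj | ==-refl (special S) = refl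
    dd-special : dd (special S) ≡ 2
    dd-special rewrite special-adj = refl
    twice-elsewhere : ∀ w → (g ∖ special S) w ≡ (dd ∖ special S) w
    twice-elsewhere w with w == special S
    ... | true = refl
    ... | false with adj G u w
    ...   | true = refl
    ...   | false = refl

  unique-from-count : ∀ γ → holders γ ≡ 1 → Σ (Fin (n G)) λ v → UniqueSpare G u S v γ
  unique-from-count γ one with sum-pos (ind ∘ holder γ) (≤-reflexive (sym one))
  ... | v , hv = v , ∧-conicalˡ _ _ holds , ∧-conicalʳ (adj G u v) _ holds , others
    where
    H : Fin (n G) → Bool
    H = holder γ
    holds : H v ≡ true
    holds = ind-true hv
    rest-empty : sum ((ind ∘ H) ∖ v) ≡ 0
    rest-empty = +-cancelˡ-≡ 1 _ 0 (trans (cong (_+ sum ((ind ∘ H) ∖ v)) (sym (cong ind holds)))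
                                         (trans (sym (sum-split (ind ∘ H) v)) one))
    others : ∀ w → adj G u w ≡ true → w ≢ v → spare S w γ ≡ false
    others w aw w≢v = ∧-false (ind-false (trans (sym (cong (λ t → if t then 0 else ind (H w)) (≢⇒==-false w≢v)))
                                                (sum≡0 _ rest-empty w))) aw

make-special-adjacent : ∀ {k} G u (S : Config k G u) w₀ → adj G u w₀ ≡ true →
  Σ (Config k G u) λ S₀ → adj G u (special S₀) ≡ true
make-special-adjacent G u S w₀ a₀ with bool-cases (adj G u (special S))
... | inj₁ as = S , as
... | inj₂ ns = record S { special = w₀ ; miss₂-ok = λ w aw _ →
                  miss₂-ok S w aw (λ e → false≢true ns (subst (λ z → adj G u z ≡ true) e aw)) } , a₀

-- The extension lemma, by induction on the number of colours: count spare
-- colours; a colour held by exactly one neighbour (possibly after a Kempe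
-- interchange) lets us colour one edge at u and recurse with one colour fewer.
extension : ∀ k → Extendable k
extension zero G u S = extend-isolated G u S (λ w → ind-false (sum≡0 _ (n≤0⇒n≡0 (deg-bound S)) w))
extension (suc k') G u S with count (adj G u) ≟ 0
... | yes isolated = extend-isolated G u S (λ w → ind-false (sum≡0 _ isolated w))
... | no has-nbr with sum-pos (ind ∘ adj G u) (n≢0⇒n>0 has-nbr)
...   | w₀ , a₀ with make-special-adjacent G u S w₀ (ind-true a₀)
...     | S₀ , special-adj with odd-total holders< spares-odd spares-below
  where
  open SpareCount G u S₀ special-adj
  spares-odd : Odd (sum holders<)
  spares-odd = one-less-than-double-odd _ d has-nbr total
  spares-below : sum holders< < suc k' + suc k'
  spares-below = subst (_≤ suc k' + suc k') (trans (sym total) (+-comm _ 1)) (+-mono-≤ (deg-bound S₀) (deg-bound S₀))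
...       | inj₁ (γ , one) with SpareCount.unique-from-count G u S₀ special-adj (toℕ γ) one
...         | v , unique = ReduceUniqueSpare.result (extension k') G u S₀ v (toℕ γ) unique
extension (suc k') G u S | no has-nbr | w₀ , a₀ | S₀ , special-adj | inj₂ ((α , α-odd) , (β , none))
  with KempeInterchange.result G u S₀ (toℕ α) (toℕ β) (toℕ<n β) β-unused α-odd
  where
  β-unused : ∀ w → adj G u w ≡ true → spare S₀ w (toℕ β) ≡ false
  β-unused w aw = ∧-false (ind-false (sum≡0 _ none w)) aw
... | S' , v , unique = ReduceUniqueSpare.result (extension k') G u S' v (toℕ β) unique

module MissingColours {m : ℕ} (E : Fin m → Fin m → Bool) (K : ℕ) (c : Fin m → Fin m → ℕ) where

  used : Fin m → ℕ → Bool
  used w γ = is-just (find (λ x → E w x ∧ (c w x =ℕ γ)))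

  missing : Fin m → Fin K → Bool
  missing w γ = not (used w (toℕ γ))

  orZero : Maybe (Fin K) → ℕ
  orZero (just γ) = toℕ γ
  orZero nothing = 0

  first : Fin m → ℕ
  first w = orZero (find (missing w))

  missingOther : Fin m → Fin K → Bool
  missingOther w γ = missing w γ ∧ not (toℕ γ =ℕ first w)

  second : Fin m → ℕ
  second w = orZero (find (missingOther w))

  missing-misses : ∀ w γ → missing w γ ≡ true → ∀ x → E w x ≡ true → c w x ≢ toℕ γ
  missing-misses w γ e x a ce with find (λ x → E w x ∧ (c w x =ℕ toℕ γ)) in eq
  ... | just _ = false≢true (not-injective e) refl
  ... | nothing = false≢true (find-nothing _ eq x) (∧-intro a (≡⇒=ℕ ce))

  used≤degree : ∀ w → count {K} (λ γ → used w (toℕ γ)) ≤ count (E w)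
  used≤degree w = begin
    count {K} (λ γ → used w (toℕ γ))                                  ≤⟨ sum-mono used≤edges ⟩
    sum {K} (λ γ → count (λ x → E w x ∧ (c w x =ℕ toℕ γ)))            ≡⟨ ∑-comm {K} {m} (λ γ x → ind (E w x ∧ (c w x =ℕ toℕ γ))) ⟩
    sum (λ x → count {K} (λ γ → E w x ∧ (c w x =ℕ toℕ γ)))            ≤⟨ sum-mono one-colour-per-edge ⟩
    count (E w)                                                      ∎
    where
    open ≤-Reasoning
    used≤edges : ∀ (γ : Fin K) → ind (used w (toℕ γ)) ≤ count (λ x → E w x ∧ (c w x =ℕ toℕ γ))
    used≤edges γ with find (λ x → E w x ∧ (c w x =ℕ toℕ γ)) in eq
    ... | nothing = z≤n
    ... | just x = ≤-trans (≤-reflexive (cong ind (sym (find-just _ eq)))) (term≤sum _ x)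
    one-colour-per-edge : ∀ x → count {K} (λ γ → E w x ∧ (c w x =ℕ toℕ γ)) ≤ ind (E w x)
    one-colour-per-edge x with E w x
    ... | false = ≤-reflexive (sum-replicate-zero K)
    ... | true with c w x <? K
    ...   | yes lt = ≤-reflexive (count-colour (c w x) lt)
    ...   | no ge = ≤-trans (≤-reflexive (trans (sum-cong-≗ {K} (λ γ → cong ind (≢⇒=ℕ-false {c w x} {toℕ γ}
                              (λ e → ge (subst (_< K) (sym e) (toℕ<n γ))))))
                              (sum-replicate-zero K))) z≤n

  two-missing-colours : ∀ w → count (E w) + 2 ≤ K → 2 ≤ count (missing w)
  two-missing-colours w room = +-cancelʳ-≤ (count (E w)) 2 _ (begin
    2 + count (E w)                                          ≡⟨ +-comm 2 _ ⟩
    count (E w) + 2                                          ≤⟨ room ⟩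
    K                                                        ≡⟨ trans (sym (*-identityʳ K)) (sym (sum-const {K} 1)) ⟩
    sum {K} (λ _ → 1)                                        ≡⟨ sum-cong-≗ {K} (λ γ → ind-not (used w (toℕ γ))) ⟨
    sum {K} (λ γ → ind (used w (toℕ γ)) + ind (missing w γ)) ≡⟨ ∑-distrib-+ {K} _ _ ⟩
    count {K} (λ γ → used w (toℕ γ)) + count (missing w)     ≤⟨ +-monoˡ-≤ _ (used≤degree w) ⟩
    count (E w) + count (missing w)                          ≡⟨ +-comm _ (count (missing w)) ⟩
    count (missing w) + count (E w)                          ∎)
    where open ≤-Reasoning

  two-missing : ∀ w → count (E w) + 2 ≤ K →
    (∀ x → E w x ≡ true → c w x ≢ first w) × first w < K ×
    (∀ x → E w x ≡ true → c w x ≢ second w) × second w < K × first w ≢ second w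
  two-missing w room with count-pos⇒find (missing w) (≤-trans (s≤s z≤n) (two-missing-colours w room))
  ... | γ₁ , found₁ , m₁ with count-pos⇒find (missingOther w) (begin
        1                                                 ≤⟨ s≤s⁻¹ (≤-trans (two-missing-colours w room) (≤-reflexive (count-remove (missing w) γ₁ m₁))) ⟩
        count (λ γ → missing w γ ∧ not (γ == γ₁))         ≡⟨ sum-cong-≗ (λ γ → cong ind (other≡ γ)) ⟩
        count (missingOther w)                            ∎)
    where
    open ≤-Reasoning
    other≡ : ∀ γ → (missing w γ ∧ not (γ == γ₁)) ≡ missingOther w γ
    other≡ γ rewrite found₁ = cong (λ b → missing w γ ∧ not b) (same-test γ)
      where
      same-test : ∀ γ → (γ == γ₁) ≡ (toℕ γ =ℕ toℕ γ₁)
      same-test γ with γ ≟F γ₁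
      ... | yes refl = sym (=ℕ-refl (toℕ γ))
      ... | no ne = sym (≢⇒=ℕ-false (ne ∘ toℕ-injective))
  ...   | γ₂ , found₂ , m₂ rewrite found₂ | found₁ =
          missing-misses w γ₁ m₁ , toℕ<n γ₁ ,
          missing-misses w γ₂ (∧-conicalˡ _ _ m₂) , toℕ<n γ₂ ,
          (λ e → false≢true (not-injective (∧-conicalʳ (missing w γ₂) _ m₂)) (≡⇒=ℕ (sym e)))

-- Vizing's theorem: colour the subgraphs induced by the first j vertices
-- with Δ + 1 colours, adding one vertex at a time by the extension lemma.
-- Each earlier neighbour w of the new vertex u has at most Δ - 1 edges
-- avoiding u, hence two missing colours.
module Vizing (G : Graph) where

  K : ℕ
  K = suc (Δ G)

  N : ℕ
  N = n G

  inPrefix : ℕ → Fin N → Bool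
  inPrefix j x = does (toℕ x <? j)

  inPrefix⇒< : ∀ {j x} → inPrefix j x ≡ true → toℕ x < j
  inPrefix⇒< {j} {x} e with toℕ x <? j
  ... | yes p = p
  ... | no ¬p = ⊥-elim (false≢true (dec-false (toℕ x <? j) ¬p) e)

  <⇒inPrefix : ∀ {j x} → toℕ x < j → inPrefix j x ≡ true
  <⇒inPrefix {j} {x} = dec-true (toℕ x <? j)

  prefix : ℕ → Graph
  prefix j = record
    { n = N
    ; adj = λ x y → (inPrefix j x ∧ inPrefix j y) ∧ adj G x y
    ; sym = λ x y → cong₂ _∧_ (∧-comm (inPrefix j x) (inPrefix j y)) (adj-sym G x y)
    ; irrefl = λ x → trans (cong ((inPrefix j x ∧ inPrefix j x) ∧_) (adj-irrefl G x)) (∧-zeroʳ _)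
    }

  prefix⇒adj : ∀ {j x y} → adj (prefix j) x y ≡ true → adj G x y ≡ true
  prefix⇒adj {j} {x} {y} = ∧-conicalʳ (inPrefix j x ∧ inPrefix j y) _

  prefix-zero : Colouring (prefix 0) K
  prefix-zero = (λ _ _ → 0) , record
    { col-sym = λ x y a → ⊥-elim (no-edge x y a)
    ; col-proper = λ x y z a _ _ → ⊥-elim (no-edge x y a)
    ; col-bound = λ x y a → ⊥-elim (no-edge x y a) }
    where
    no-edge : ∀ x y → adj (prefix 0) x y ≡ true → ⊥
    no-edge x y a with inPrefix⇒< {0} {x} (∧-conicalˡ (inPrefix 0 x) (inPrefix 0 y) (∧-conicalˡ (inPrefix 0 x ∧ inPrefix 0 y) (adj G x y) a))
    ... | ()

  prefix-all : Colouring (prefix N) K → Colouring G K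
  prefix-all (c , P) = c , IsProper-⊆ (λ {x} {y} a → ∧-intro (∧-intro (<⇒inPrefix (toℕ<n x)) (<⇒inPrefix (toℕ<n y))) a) P

  module AddVertex (j : ℕ) (j<N : j < N) (colouring : Colouring (prefix j) K) where
    H : Graph
    H = prefix (suc j)

    u : Fin N
    u = fromℕ< j<N

    c : Fin N → Fin N → ℕ
    c = proj₁ colouring

    H⁻⊆prefix : ∀ {x y} → adj⁻ H u x y ≡ true → adj (prefix j) x y ≡ true
    H⁻⊆prefix {x} {y} a =
      let inH = ∧-conicalˡ _ (adj G x y) (adj⁻⇒adj H u {x} {y} a)
      in ∧-intro (∧-intro (earlier (∧-conicalˡ _ _ inH) (adj⁻⇒≢₁ H u {x} {y} a))
                          (earlier (∧-conicalʳ (inPrefix (suc j) x) _ inH) (adj⁻⇒≢₂ H u {x} {y} a)))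
                 (prefix⇒adj {suc j} {x} {y} (adj⁻⇒adj H u {x} {y} a))
      where
      earlier : ∀ {x} → inPrefix (suc j) x ≡ true → x ≢ u → inPrefix j x ≡ true
      earlier e ne = <⇒inPrefix (≤∧≢⇒< (s≤s⁻¹ (inPrefix⇒< e))
                       (λ ex → ne (toℕ-injective (trans ex (sym (toℕ-fromℕ< j<N))))))

    P : IsProper (adj⁻ H u) K c
    P = IsProper-⊆ H⁻⊆prefix (proj₂ colouring)

    open MissingColours (adj⁻ H u) K c

    room : ∀ w → adj H u w ≡ true → count (adj⁻ H u w) + 2 ≤ K
    room w a = subst (_≤ K) (sym (+-suc (count (adj⁻ H u w)) 1)) (s≤s (begin
      count (adj⁻ H u w) + 1                    ≡⟨ +-comm _ 1 ⟩
      1 + count (adj⁻ H u w)                    ≤⟨ +-mono-≤ (≤-reflexive (cong ind (sym wu))) (sum-mono avoid-u) ⟩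
      d u + sum (d ∖ u)                         ≡⟨ sum-split d u ⟨
      count (adj G w)                           ≡⟨ degree-count G w ⟨
      deg G w                                   ≤⟨ deg≤Δ G w ⟩
      Δ G                                       ∎))
      where
      open ≤-Reasoning
      d : Fin N → ℕ
      d = ind ∘ adj G w
      wu : adj G w u ≡ true
      wu = trans (adj-sym G w u) (prefix⇒adj {suc j} a)
      avoid-u : ∀ x → ind (adj⁻ H u w x) ≤ (d ∖ u) x
      avoid-u x with bool-cases (adj⁻ H u w x)
      ... | inj₂ e rewrite e = z≤n
      ... | inj₁ e = ≤-reflexive (trans (cong ind e) (sym (trans
              (cong (λ b → if b then 0 else d x) (≢⇒==-false (adj⁻⇒≢₂ H u {w} {x} e)))
              (cong ind (prefix⇒adj {suc j} {w} {x} (adj⁻⇒adj H u {w} {x} e))))))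

    config : Config K H u
    config = record
      { col       = c
      ; col-ok    = P
      ; special   = u
      ; miss₁     = first
      ; miss₂     = second
      ; miss₁-ok  = λ w a → let (m₁ , b₁ , _) = two-missing w (room w a) in m₁ , b₁
      ; miss₂-ok  = λ w a _ → proj₂ (proj₂ (two-missing w (room w a)))
      ; deg-bound = ≤-trans (sum-mono (λ w → ind-∧ʳ (inPrefix (suc j) u ∧ inPrefix (suc j) w) (adj G u w)))
                    (≤-trans (≤-reflexive (sym (degree-count G u))) (≤-trans (deg≤Δ G u) (n≤1+n _)))
      }

    result : Colouring H K
    result = extension K H u config

  colour-prefix : ∀ j → j ≤ N → Colouring (prefix j) K
  colour-prefix zero _ = prefix-zero
  colour-prefix (suc j) le = AddVertex.result j le (colour-prefix j (≤-trans (n≤1+n j) le))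

vizing : ∀ G → EdgeColouring G (suc (Δ G))
vizing G = toEdgeColouring G (Δ G) (prefix-all (colour-prefix N ≤-refl))
  where open Vizing G

vs-≤ : ∀ ρ σ {G r s} → (∀ S → Destab ρ G S → Destab σ G S) → IsVS σ G s → IsVS ρ G r → s ≤ r
vs-≤ _ _ ρ⇒σ (_ , σ-least) ((S , dS , refl) , _) = σ-least S (ρ⇒σ S dS)

vs-⊓-≤ : ∀ ρ σ τ {G r s t} → (∀ S → Destab ρ G S → Destab σ G S ⊎ Destab τ G S) →
         IsVS ρ G r → IsVS σ G s → IsVS τ G t → s ⊓ t ≤ r
vs-⊓-≤ _ _ _ split ((S , dS , refl) , _) (_ , σ-least) (_ , τ-least) with split S dS
... | inj₁ dσ = ≤-trans (m⊓n≤m _ _) (σ-least S dσ)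
... | inj₂ dτ = ≤-trans (m⊓n≤n _ _) (τ-least S dτ)

-- If χ'(G - S) = Δ(G) + 1 then Δ(G - S) = Δ(G): by Vizing's theorem
-- Δ(G) + 1 = χ'(G - S) ≤ Δ(G - S) + 1, and deletion cannot raise Δ.
χ′-kept⇒Δ-kept : ∀ G S → IsChromaticIndex (removeV G S) (suc (Δ G)) → Δ (removeV G S) ≡ Δ G
χ′-kept⇒Δ-kept G S (_ , least) =
  ≤-antisym (Δ-removeV G S) (s≤s⁻¹ (least _ (vizing (removeV G S))))

Δ-destab⇒χ′-destab : ∀ G → Class2 G → ∀ S → Destab ΔInv G S → Destab χ′ G S
Δ-destab⇒χ′-destab G c2 S (inj₂ empty) = inj₂ empty
Δ-destab⇒χ′-destab G c2 S (inj₁ Δ-differs) = inj₁ λ k χG χH →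
  Δ-differs (Δ G) refl (χ′-kept⇒Δ-kept G S (subst (IsChromaticIndex (removeV G S)) (chromaticIndex-unique {G} χG c2) χH))

-- Changing the class changes χ' (class 2 graphs): if χ' is kept, so is Δ,
-- and then so is the class.
class-destab⇒χ′-destab : ∀ G → Class2 G → ∀ S → Destab classInv G S → Destab χ′ G S
class-destab⇒χ′-destab G c2 S (inj₂ empty) = inj₂ empty
class-destab⇒χ′-destab G c2 S (inj₁ class-differs) = inj₁ λ k χG χH →
  let χH' = subst (IsChromaticIndex (removeV G S)) (chromaticIndex-unique {G} χG c2) χH
      ΔH≡ΔG = χ′-kept⇒Δ-kept G S χH'
  in class-differs 2 (suc (Δ G) , c2 , class-two (Δ G))
                     (suc (Δ G) , χH' , trans (cong (2 +_) ΔH≡ΔG) (class-two (Δ G)))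
  where
  class-two : ∀ m → 2 + m ≡ suc m + 1
  class-two m = cong suc (+-comm 1 m)

-- Changing χ' changes Δ or the class, since class = χ' - Δ + 1.
χ′-destab⇒Δ-or-class : ∀ G S → Destab χ′ G S → Destab ΔInv G S ⊎ Destab classInv G S
χ′-destab⇒Δ-or-class G S (inj₂ empty) = inj₁ (inj₂ empty)
χ′-destab⇒Δ-or-class G S (inj₁ χ-differs) with Δ (removeV G S) ≟ Δ G
... | no Δ-changed = inj₁ (inj₁ λ k ΔG ΔH → Δ-changed (trans ΔH (sym ΔG)))
... | yes Δ-kept = inj₂ (inj₁ λ k (χ , χG , eG) (χ' , χH , eH) →
        χ-differs χ χG (subst (IsChromaticIndex (removeV G S)) (+-cancelʳ-≡ 1 χ' χ
          (trans (sym eH) (trans (cong (k +_) Δ-kept) eG))) χH))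

mainTheorem6 : (G : Graph) → Class2 G → (a b c : ℕ) →
    IsVS χ′ G a → IsVS ΔInv G b → IsVS classInv G c → a ≡ b ⊓ c
mainTheorem6 G c2 a b c vsχ′ vsΔ vsClass =
  ≤-antisym (⊓-glb (vs-≤ ΔInv χ′ {G} {b} {a} (Δ-destab⇒χ′-destab G c2) vsχ′ vsΔ)
                   (vs-≤ classInv χ′ {G} {c} {a} (class-destab⇒χ′-destab G c2) vsχ′ vsClass))
            (vs-⊓-≤ χ′ ΔInv classInv {G} {a} {b} {c} (χ′-destab⇒Δ-or-class G) vsχ′ vsΔ vsClass)
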